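{- If $\Gamma \vdash M = N : A\,!\,\Sigma$ is derivable in $\lambda_{\mathrm{eff}}$, then the CPS transforms $\overline M$ and $\overline N$ are equal modulo $\beta$/$\eta$-equivalence in System F. In particular, if $M \leadsto N$ in $\lambda_{\mathrm{eff}}$, then $\overline M$ and $\overline N$ are equal modulo $\beta$/$\eta$-equivalence.
   Context: $\lambda_{\mathrm{eff}}$: fine-grain CBV calculus of deep effect handlers with computations $V\,W$, $\mathtt{return}\ V$, $\mathtt{let}\ x\Leftarrow M\ \mathtt{in}\ N$, $\mathtt{op}(V)$, $\mathtt{handle}\ M\ \mathtt{with}\ H\ \mathtt{to}\ x.N$; signatures are finite sets of entries $\mathtt{op}:A_{\mathtt{op}}\to B_{\mathtt{op}}$ (operation-signature arrow). Its equational theory is the least congruence containing $\beta/\eta$ for functions and products, the monad laws for $\mathtt{let}$, and the handler laws $\mathtt{handle}\ \mathtt{return}\ V\ \mathtt{with}\ H\ \mathtt{to}\ x.M=M[V/x]$, $\mathtt{handle}\ (\mathtt{let}\ x\Leftarrow L\ \mathtt{in}\ M)\ \mathtt{with}\ H\ \mathtt{to}\ y.N=\mathtt{handle}\ L\ \mathtt{with}\ H\ \mathtt{to}\ x.(\mathtt{handle}\ M\ \mathtt{with}\ H\ \mathtt{to}\ y.N)$, $\mathtt{handle}\ \mathtt{op}(V)\ \mathtt{with}\ H\ \mathtt{to}\ x.M=M_{\mathtt{op}}[V/x,\lambda x.M/k]$. $\leadsto$ is the small-step reduction on closed computations with evaluation contexts $E::=[\,]\mid\mathtt{let}\ x\Leftarrow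 E\ \mathtt{in}\ N\mid\mathtt{handle}\ E\ \mathtt{with}\ H\ \mathtt{to}\ x.M$, closed under contexts, with rules $\mathtt{let}\ x\Leftarrow\mathtt{return}\ V\ \mathtt{in}\ M\leadsto M[V/x]$, $(\lambda x.M)V\leadsto M[V/x]$, $\mathtt{handle}\ \mathtt{return}\ V\ \mathtt{with}\ H\ \mathtt{to}\ x.M\leadsto M[V/x]$, and $\mathtt{handle}\ E[\mathtt{op}(V)]\ \mathtt{with}\ H\ \mathtt{to}\ x.M\leadsto M_{\mathtt{op}}[V/x,\lambda y.\mathtt{handle}\ E[\mathtt{return}\ y]\ \mathtt{with}\ H\ \mathtt{to}\ x.M/k]$ when $E$ contains no handle-with. The CPS transform $\overline{(-)}$ into System F: $\overline{A!\Sigma}=\forall\beta.(\overline A\to\beta)\to\mathcal{H}_\Sigma[\beta]\to\beta$ with $\mathcal{H}_\Sigma[\beta]=\prod_{\mathtt{op}}(\overline{A_{\mathtt{op}}}\times(\overline{B_{\mathtt{op}}}\to\beta)\to\beta)$; $\overline{\mathtt{return}\ V}=\Lambda\beta.\lambda k.\lambda h.k\,\overline V$; $\overline{\mathtt{let}\ x\Leftarrow M\ \mathtt{in}\ N}=\Lambda\beta.\lambda k.\lambda h.\overline M\,\beta\,(\lambda x.\overline N\,\beta\,k\,h)\,h$; $\overline{\mathtt{op}(V)}=\Lambda\beta.\lambda k.\lambda h.\pi_{\mathtt{op}}\,h\,\langle\overline V,k\rangle$; $\overline{\mathtt{handle}\ M\ \mathtt{with}\ H\ \mathtt{to}\ x.N}=\overline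 M\,\overline C\,(\lambda x.\overline N)\,\overline H$ ($N:C$); handlers to tuples $\langle\lambda\langle x,k\rangle.\overline{M_{\mathtt{op}}}\rangle$; values homomorphically. -}

module Defs where

open import Data.Nat using (ℕ; zero; suc)
open import Data.Fin using (Fin; zero; suc)
open import Data.Vec using (Vec; []; _∷_; lookup; map)

-- Part 1. The source calculus λ_eff (fine-grain CBV, deep handlers),
-- intrinsically typed, de Bruijn variables.

infixr 7 _⇒_
infixr 8 _⊗_
infix  6 _!_
infixl 5 _▹_↦_
infixl 5 _▸_

mutual
  data VTy : Set where
    𝟙   : VTy
    _⊗_ : VTy → VTy → VTy
    _⇒_ : VTy → CTy → VTy

  data CTy : Set where
    _!_ : VTy → Sig → CTy

  data Sig : Set where
    ∅     : Sig
    _▹_↦_ : Sig → VTy → VTy → Sig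

data Op : Sig → VTy → VTy → Set where
  here  : ∀ {S A B} → Op (S ▹ A ↦ B) A B
  there : ∀ {S A B A' B'} → Op S A B → Op (S ▹ A' ↦ B') A B

data Ctx : Set where
  ε   : Ctx
  _▸_ : Ctx → VTy → Ctx

variable
  Γ Δ : Ctx
  A B A' B' : VTy
  C D : CTy
  S : Sig

data Var : Ctx → VTy → Set where
  vz : Var (Γ ▸ A) A
  vs : Var Γ A → Var (Γ ▸ B) A

mutual
  data Val (Γ : Ctx) : VTy → Set where
    var  : Var Γ A → Val Γ A
    tt   : Val Γ 𝟙
    pair : Val Γ A → Val Γ B → Val Γ (A ⊗ B)
    fst  : Val Γ (A ⊗ B) → Val Γ A
    snd  : Val Γ (A ⊗ B) → Val Γ B
    lam  : Comp (Γ ▸ A) C → Val Γ (A ⇒ C)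

  data Comp (Γ : Ctx) : CTy → Set where
    app     : Val Γ (A ⇒ C) → Val Γ A → Comp Γ C
    ret     : Val Γ A → Comp Γ (A ! S)
    `let    : Comp Γ (A ! S) → Comp (Γ ▸ A) (B ! S) → Comp Γ (B ! S)
    perform : Op S A B → Val Γ A → Comp Γ (B ! S)
    -- handle M with H to x.N
    handle  : Comp Γ (A ! S) → Handler Γ S C → Comp (Γ ▸ A) C → Comp Γ C

  -- a handler for Σ with result type C: one clause  op(x; k) ↦ M_op
  -- per operation, with x : A_op and k : B_op → C (k is the innermost variable)
  data Handler (Γ : Ctx) : Sig → CTy → Set where
    []  : Handler Γ ∅ C
    _∷_ : Handler Γ S C → Comp (Γ ▸ A ▸ (B ⇒ C)) C → Handler Γ (S ▹ A ↦ B) C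

clause : Handler Γ S C → Op S A B → Comp (Γ ▸ A ▸ (B ⇒ C)) C
clause (H ∷ M) here      = M
clause (H ∷ M) (there o) = clause H o

Ren : Ctx → Ctx → Set
Ren Γ Δ = ∀ {A} → Var Γ A → Var Δ A

extR : Ren Γ Δ → Ren (Γ ▸ A) (Δ ▸ A)
extR ρ vz     = vz
extR ρ (vs x) = vs (ρ x)

mutual
  renV : Ren Γ Δ → Val Γ A → Val Δ A
  renV ρ (var x)    = var (ρ x)
  renV ρ tt         = tt
  renV ρ (pair V W) = pair (renV ρ V) (renV ρ W)
  renV ρ (fst V)    = fst (renV ρ V)
  renV ρ (snd V)    = snd (renV ρ V)
  renV ρ (lam M)    = lam (renC (extR ρ) M)

  renC : Ren Γ Δ → Comp Γ C → Comp Δ C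
  renC ρ (app V W)     = app (renV ρ V) (renV ρ W)
  renC ρ (ret V)       = ret (renV ρ V)
  renC ρ (`let M N)    = `let (renC ρ M) (renC (extR ρ) N)
  renC ρ (perform o V) = perform o (renV ρ V)
  renC ρ (handle M H N) = handle (renC ρ M) (renH ρ H) (renC (extR ρ) N)

  renH : Ren Γ Δ → Handler Γ S C → Handler Δ S C
  renH ρ []      = []
  renH ρ (H ∷ M) = renH ρ H ∷ renC (extR (extR ρ)) M

Sub : Ctx → Ctx → Set
Sub Γ Δ = ∀ {A} → Var Γ A → Val Δ A

extS : Sub Γ Δ → Sub (Γ ▸ A) (Δ ▸ A)
extS σ vz     = var vz
extS σ (vs x) = renV vs (σ x)

mutual
  subV : Sub Γ Δ → Val Γ A → Val Δ A
  subV σ (var x)    = σ x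
  subV σ tt         = tt
  subV σ (pair V W) = pair (subV σ V) (subV σ W)
  subV σ (fst V)    = fst (subV σ V)
  subV σ (snd V)    = snd (subV σ V)
  subV σ (lam M)    = lam (subC (extS σ) M)

  subC : Sub Γ Δ → Comp Γ C → Comp Δ C
  subC σ (app V W)      = app (subV σ V) (subV σ W)
  subC σ (ret V)        = ret (subV σ V)
  subC σ (`let M N)     = `let (subC σ M) (subC (extS σ) N)
  subC σ (perform o V)  = perform o (subV σ V)
  subC σ (handle M H N) = handle (subC σ M) (subH σ H) (subC (extS σ) N)

  subH : Sub Γ Δ → Handler Γ S C → Handler Δ S C
  subH σ []      = []
  subH σ (H ∷ M) = subH σ H ∷ subC (extS (extS σ)) M

sub₀ : Val Γ A → Sub (Γ ▸ A) Γ
sub₀ V vz     = V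
sub₀ V (vs x) = var x

_[_]₀ : Comp (Γ ▸ A) C → Val Γ A → Comp Γ C
M [ V ]₀ = subC (sub₀ V) M

sub₂ : Val Γ A → Val Γ B → Sub (Γ ▸ A ▸ B) Γ
sub₂ V W vz          = W
sub₂ V W (vs vz)     = V
sub₂ V W (vs (vs x)) = var x

wkV : Val Γ A → Val (Γ ▸ B) A
wkV = renV vs

infix 4 _≈v_ _≈c_ _≈h_

mutual
  data _≈v_ : {Γ : Ctx} {A : VTy} → Val Γ A → Val Γ A → Set where
    ≈refl  : {V : Val Γ A} → V ≈v V
    ≈sym   : {V W : Val Γ A} → V ≈v W → W ≈v V
    ≈trans : {U V W : Val Γ A} → U ≈v V → V ≈v W → U ≈v W
    pair-cong : {V V' : Val Γ A} {W W' : Val Γ B} →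
                V ≈v V' → W ≈v W' → pair V W ≈v pair V' W'
    fst-cong  : {V V' : Val Γ (A ⊗ B)} → V ≈v V' → fst V ≈v fst V'
    snd-cong  : {V V' : Val Γ (A ⊗ B)} → V ≈v V' → snd V ≈v snd V'
    lam-cong  : {M M' : Comp (Γ ▸ A) C} → M ≈c M' → lam M ≈v lam M'
    β-fst  : {V : Val Γ A} {W : Val Γ B} → fst (pair V W) ≈v V
    β-snd  : {V : Val Γ A} {W : Val Γ B} → snd (pair V W) ≈v W
    η-pair : {V : Val Γ (A ⊗ B)} → V ≈v pair (fst V) (snd V)
    η-unit : {V : Val Γ 𝟙} → V ≈v tt
    η-fun  : {V : Val Γ (A ⇒ C)} → V ≈v lam (app (wkV V) (var vz))

  data _≈c_ : {Γ : Ctx} {C : CTy} → Comp Γ C → Comp Γ C → Set where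
    ≈refl  : {M : Comp Γ C} → M ≈c M
    ≈sym   : {M N : Comp Γ C} → M ≈c N → N ≈c M
    ≈trans : {L M N : Comp Γ C} → L ≈c M → M ≈c N → L ≈c N
    app-cong : {V V' : Val Γ (A ⇒ C)} {W W' : Val Γ A} →
               V ≈v V' → W ≈v W' → app V W ≈c app V' W'
    ret-cong : {V V' : Val Γ A} → V ≈v V' → ret {S = S} V ≈c ret V'
    let-cong : {M M' : Comp Γ (A ! S)} {N N' : Comp (Γ ▸ A) (B ! S)} →
               M ≈c M' → N ≈c N' → `let M N ≈c `let M' N'
    perform-cong : {o : Op S A B} {V V' : Val Γ A} →
                   V ≈v V' → perform o V ≈c perform o V'
    handle-cong : {M M' : Comp Γ (A ! S)} {H H' : Handler Γ S C}
                  {N N' : Comp (Γ ▸ A) C} →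
                  M ≈c M' → H ≈h H' → N ≈c N' → handle M H N ≈c handle M' H' N'
    β-fun : {M : Comp (Γ ▸ A) C} {V : Val Γ A} → app (lam M) V ≈c M [ V ]₀
    let-β : {V : Val Γ A} {M : Comp (Γ ▸ A) (B ! S)} →
            `let (ret V) M ≈c M [ V ]₀
    let-η : {M : Comp Γ (A ! S)} → `let M (ret (var vz)) ≈c M
    let-assoc : {L : Comp Γ (A ! S)} {M : Comp (Γ ▸ A) (B ! S)}
                {N : Comp (Γ ▸ B) (A' ! S)} →
                `let (`let L M) N ≈c `let L (`let M (renC (extR vs) N))
    handle-ret : {V : Val Γ A} {H : Handler Γ S C} {M : Comp (Γ ▸ A) C} →
                 handle (ret V) H M ≈c M [ V ]₀
    handle-let : {L : Comp Γ (A ! S)} {M : Comp (Γ ▸ A) (B ! S)}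
                 {H : Handler Γ S C} {N : Comp (Γ ▸ B) C} →
                 handle (`let L M) H N
                   ≈c handle L H (handle M (renH vs H) (renC (extR vs) N))
    handle-op : {o : Op S A B} {V : Val Γ A} {H : Handler Γ S C}
                {M : Comp (Γ ▸ B) C} →
                handle (perform o V) H M ≈c subC (sub₂ V (lam M)) (clause H o)

  data _≈h_ : {Γ : Ctx} {S : Sig} {C : CTy} → Handler Γ S C → Handler Γ S C → Set where
    []  : _≈h_ {Γ} {∅} {C} [] []
    _∷_ : {H H' : Handler Γ S C} {M M' : Comp (Γ ▸ A ▸ (B ⇒ C)) C} →
          H ≈h H' → M ≈c M' → (H ∷ M) ≈h (H' ∷ M')

-- handle-free evaluation contexts  E ::= [ ] | let x ⇐ E in N
-- ECtx Γ C D : hole of type C, whole of type D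
data ECtx (Γ : Ctx) : CTy → CTy → Set where
  □    : ECtx Γ C C
  `let : ECtx Γ C (A ! S) → Comp (Γ ▸ A) (B ! S) → ECtx Γ C (B ! S)

plug : ECtx Γ C D → Comp Γ C → Comp Γ D
plug □          M = M
plug (`let E N) M = `let (plug E M) N

renE : Ren Γ Δ → ECtx Γ C D → ECtx Δ C D
renE ρ □          = □
renE ρ (`let E N) = `let (renE ρ E) (renC (extR ρ) N)

infix 4 _⇝_

data _⇝_ : {Γ : Ctx} {C : CTy} → Comp Γ C → Comp Γ C → Set where
  β-let : {V : Val Γ A} {M : Comp (Γ ▸ A) (B ! S)} → `let (ret V) M ⇝ M [ V ]₀
  β-app : {M : Comp (Γ ▸ A) C} {V : Val Γ A} → app (lam M) V ⇝ M [ V ]₀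
  β-ret : {V : Val Γ A} {H : Handler Γ S C} {M : Comp (Γ ▸ A) C} →
          handle (ret V) H M ⇝ M [ V ]₀
  β-op  : {E : ECtx Γ (B ! S) (A ! S)} {o : Op S A' B} {V : Val Γ A'}
          {H : Handler Γ S C} {M : Comp (Γ ▸ A) C} →
          handle (plug E (perform o V)) H M
            ⇝ subC (sub₂ V (lam (handle (plug (renE vs E) (ret (var vz)))
                                         (renH vs H) (renC (extR vs) M))))
                   (clause H o)
  ξ-let : {M M' : Comp Γ (A ! S)} {N : Comp (Γ ▸ A) (B ! S)} →
          M ⇝ M' → `let M N ⇝ `let M' N
  ξ-handle : {M M' : Comp Γ (A ! S)} {H : Handler Γ S C} {N : Comp (Γ ▸ A) C} →
             M ⇝ M' → handle M H N ⇝ handle M' H N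

module F where

  infixr 7 _⟶_
  infixr 8 _⊠_

  data Ty (n : ℕ) : Set where
    tv   : Fin n → Ty n
    _⟶_  : Ty n → Ty n → Ty n
    all  : Ty (suc n) → Ty n
    _⊠_  : Ty n → Ty n → Ty n
    unit : Ty n

  extρ : ∀ {n n'} → (Fin n → Fin n') → Fin (suc n) → Fin (suc n')
  extρ ρ zero    = zero
  extρ ρ (suc i) = suc (ρ i)

  renTy : ∀ {n n'} → (Fin n → Fin n') → Ty n → Ty n'
  renTy ρ (tv i)   = tv (ρ i)
  renTy ρ (A ⟶ B)  = renTy ρ A ⟶ renTy ρ B
  renTy ρ (all A)  = all (renTy (extρ ρ) A)
  renTy ρ (A ⊠ B)  = renTy ρ A ⊠ renTy ρ B
  renTy ρ unit     = unit

  extσT : ∀ {n n'} → (Fin n → Ty n') → Fin (suc n) → Ty (suc n')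
  extσT σ zero    = tv zero
  extσT σ (suc i) = renTy suc (σ i)

  subTy : ∀ {n n'} → (Fin n → Ty n') → Ty n → Ty n'
  subTy σ (tv i)   = σ i
  subTy σ (A ⟶ B)  = subTy σ A ⟶ subTy σ B
  subTy σ (all A)  = all (subTy (extσT σ) A)
  subTy σ (A ⊠ B)  = subTy σ A ⊠ subTy σ B
  subTy σ unit     = unit

  σT₀ : ∀ {n} → Ty n → Fin (suc n) → Ty n
  σT₀ B zero    = B
  σT₀ B (suc i) = tv i

  _[_]T : ∀ {n} → Ty (suc n) → Ty n → Ty n
  A [ B ]T = subTy (σT₀ B) A

  data Tm (n m : ℕ) : Set where
    var  : Fin m → Tm n m
    lam  : Ty n → Tm n (suc m) → Tm n m
    app  : Tm n m → Tm n m → Tm n m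
    Lam  : Tm (suc n) m → Tm n m
    App  : Tm n m → Ty n → Tm n m
    pair : Tm n m → Tm n m → Tm n m
    fst  : Tm n m → Tm n m
    snd  : Tm n m → Tm n m
    unit : Tm n m

  tyRenTm : ∀ {n n' m} → (Fin n → Fin n') → Tm n m → Tm n' m
  tyRenTm ρ (var x)    = var x
  tyRenTm ρ (lam A t)  = lam (renTy ρ A) (tyRenTm ρ t)
  tyRenTm ρ (app t u)  = app (tyRenTm ρ t) (tyRenTm ρ u)
  tyRenTm ρ (Lam t)    = Lam (tyRenTm (extρ ρ) t)
  tyRenTm ρ (App t B)  = App (tyRenTm ρ t) (renTy ρ B)
  tyRenTm ρ (pair t u) = pair (tyRenTm ρ t) (tyRenTm ρ u)
  tyRenTm ρ (fst t)    = fst (tyRenTm ρ t)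
  tyRenTm ρ (snd t)    = snd (tyRenTm ρ t)
  tyRenTm ρ unit       = unit

  tySubTm : ∀ {n n' m} → (Fin n → Ty n') → Tm n m → Tm n' m
  tySubTm σ (var x)    = var x
  tySubTm σ (lam A t)  = lam (subTy σ A) (tySubTm σ t)
  tySubTm σ (app t u)  = app (tySubTm σ t) (tySubTm σ u)
  tySubTm σ (Lam t)    = Lam (tySubTm (extσT σ) t)
  tySubTm σ (App t B)  = App (tySubTm σ t) (subTy σ B)
  tySubTm σ (pair t u) = pair (tySubTm σ t) (tySubTm σ u)
  tySubTm σ (fst t)    = fst (tySubTm σ t)
  tySubTm σ (snd t)    = snd (tySubTm σ t)
  tySubTm σ unit       = unit

  _[_]Tm : ∀ {n m} → Tm (suc n) m → Ty n → Tm n m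
  t [ B ]Tm = tySubTm (σT₀ B) t

  renTm : ∀ {n m m'} → (Fin m → Fin m') → Tm n m → Tm n m'
  renTm ρ (var x)    = var (ρ x)
  renTm ρ (lam A t)  = lam A (renTm (extρ ρ) t)
  renTm ρ (app t u)  = app (renTm ρ t) (renTm ρ u)
  renTm ρ (Lam t)    = Lam (renTm ρ t)
  renTm ρ (App t B)  = App (renTm ρ t) B
  renTm ρ (pair t u) = pair (renTm ρ t) (renTm ρ u)
  renTm ρ (fst t)    = fst (renTm ρ t)
  renTm ρ (snd t)    = snd (renTm ρ t)
  renTm ρ unit       = unit

  extσ : ∀ {n m m'} → (Fin m → Tm n m') → Fin (suc m) → Tm n (suc m')
  extσ σ zero    = var zero
  extσ σ (suc i) = renTm suc (σ i)

  subTm : ∀ {n m m'} → (Fin m → Tm n m') → Tm n m → Tm n m'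
  subTm σ (var x)    = σ x
  subTm σ (lam A t)  = lam A (subTm (extσ σ) t)
  subTm σ (app t u)  = app (subTm σ t) (subTm σ u)
  subTm σ (Lam t)    = Lam (subTm (λ i → tyRenTm suc (σ i)) t)
  subTm σ (App t B)  = App (subTm σ t) B
  subTm σ (pair t u) = pair (subTm σ t) (subTm σ u)
  subTm σ (fst t)    = fst (subTm σ t)
  subTm σ (snd t)    = snd (subTm σ t)
  subTm σ unit       = unit

  σ₀ : ∀ {n m} → Tm n m → Fin (suc m) → Tm n m
  σ₀ u zero    = u
  σ₀ u (suc i) = var i

  _[_]ᶠ : ∀ {n m} → Tm n (suc m) → Tm n m → Tm n m
  t [ u ]ᶠ = subTm (σ₀ u) t

  infix 4 _⊢_∶_ _⊢_≐_∶_

  data _⊢_∶_ : {n m : ℕ} → Vec (Ty n) m → Tm n m → Ty n → Set where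
    ⊢var  : ∀ {n m} {Γ : Vec (Ty n) m} {x : Fin m} → Γ ⊢ var x ∶ lookup Γ x
    ⊢lam  : ∀ {n m} {Γ : Vec (Ty n) m} {A B t} →
            (A ∷ Γ) ⊢ t ∶ B → Γ ⊢ lam A t ∶ A ⟶ B
    ⊢app  : ∀ {n m} {Γ : Vec (Ty n) m} {A B t u} →
            Γ ⊢ t ∶ A ⟶ B → Γ ⊢ u ∶ A → Γ ⊢ app t u ∶ B
    ⊢Lam  : ∀ {n m} {Γ : Vec (Ty n) m} {A t} →
            map (renTy suc) Γ ⊢ t ∶ A → Γ ⊢ Lam t ∶ all A
    ⊢App  : ∀ {n m} {Γ : Vec (Ty n) m} {A t} {B : Ty n} →
            Γ ⊢ t ∶ all A → Γ ⊢ App t B ∶ A [ B ]T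
    ⊢pair : ∀ {n m} {Γ : Vec (Ty n) m} {A B t u} →
            Γ ⊢ t ∶ A → Γ ⊢ u ∶ B → Γ ⊢ pair t u ∶ A ⊠ B
    ⊢fst  : ∀ {n m} {Γ : Vec (Ty n) m} {A B t} →
            Γ ⊢ t ∶ A ⊠ B → Γ ⊢ fst t ∶ A
    ⊢snd  : ∀ {n m} {Γ : Vec (Ty n) m} {A B t} →
            Γ ⊢ t ∶ A ⊠ B → Γ ⊢ snd t ∶ B
    ⊢unit : ∀ {n m} {Γ : Vec (Ty n) m} → Γ ⊢ unit ∶ unit

  data _⊢_≐_∶_ : {n m : ℕ} → Vec (Ty n) m → Tm n m → Tm n m → Ty n → Set where
    ≐refl  : ∀ {n m} {Γ : Vec (Ty n) m} {t A} → Γ ⊢ t ∶ A → Γ ⊢ t ≐ t ∶ A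
    ≐sym   : ∀ {n m} {Γ : Vec (Ty n) m} {t u A} → Γ ⊢ t ≐ u ∶ A → Γ ⊢ u ≐ t ∶ A
    ≐trans : ∀ {n m} {Γ : Vec (Ty n) m} {t u v A} →
             Γ ⊢ t ≐ u ∶ A → Γ ⊢ u ≐ v ∶ A → Γ ⊢ t ≐ v ∶ A
    lam-cong  : ∀ {n m} {Γ : Vec (Ty n) m} {A B t t'} →
                (A ∷ Γ) ⊢ t ≐ t' ∶ B → Γ ⊢ lam A t ≐ lam A t' ∶ A ⟶ B
    app-cong  : ∀ {n m} {Γ : Vec (Ty n) m} {A B t t' u u'} →
                Γ ⊢ t ≐ t' ∶ A ⟶ B → Γ ⊢ u ≐ u' ∶ A → Γ ⊢ app t u ≐ app t' u' ∶ B
    Lam-cong  : ∀ {n m} {Γ : Vec (Ty n) m} {A t t'} →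
                map (renTy suc) Γ ⊢ t ≐ t' ∶ A → Γ ⊢ Lam t ≐ Lam t' ∶ all A
    App-cong  : ∀ {n m} {Γ : Vec (Ty n) m} {A t t'} {B : Ty n} →
                Γ ⊢ t ≐ t' ∶ all A → Γ ⊢ App t B ≐ App t' B ∶ A [ B ]T
    pair-cong : ∀ {n m} {Γ : Vec (Ty n) m} {A B t t' u u'} →
                Γ ⊢ t ≐ t' ∶ A → Γ ⊢ u ≐ u' ∶ B → Γ ⊢ pair t u ≐ pair t' u' ∶ A ⊠ B
    fst-cong  : ∀ {n m} {Γ : Vec (Ty n) m} {A B t t'} →
                Γ ⊢ t ≐ t' ∶ A ⊠ B → Γ ⊢ fst t ≐ fst t' ∶ A
    snd-cong  : ∀ {n m} {Γ : Vec (Ty n) m} {A B t t'} →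
                Γ ⊢ t ≐ t' ∶ A ⊠ B → Γ ⊢ snd t ≐ snd t' ∶ B
    β-fun  : ∀ {n m} {Γ : Vec (Ty n) m} {A B t u} →
             (A ∷ Γ) ⊢ t ∶ B → Γ ⊢ u ∶ A → Γ ⊢ app (lam A t) u ≐ t [ u ]ᶠ ∶ B
    η-fun  : ∀ {n m} {Γ : Vec (Ty n) m} {A B t} →
             Γ ⊢ t ∶ A ⟶ B → Γ ⊢ t ≐ lam A (app (renTm suc t) (var zero)) ∶ A ⟶ B
    β-all  : ∀ {n m} {Γ : Vec (Ty n) m} {A t} {B : Ty n} →
             map (renTy suc) Γ ⊢ t ∶ A → Γ ⊢ App (Lam t) B ≐ t [ B ]Tm ∶ A [ B ]T
    η-all  : ∀ {n m} {Γ : Vec (Ty n) m} {A t} →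
             Γ ⊢ t ∶ all A → Γ ⊢ t ≐ Lam (App (tyRenTm suc t) (tv zero)) ∶ all A
    β-fst  : ∀ {n m} {Γ : Vec (Ty n) m} {A B t u} →
             Γ ⊢ t ∶ A → Γ ⊢ u ∶ B → Γ ⊢ fst (pair t u) ≐ t ∶ A
    β-snd  : ∀ {n m} {Γ : Vec (Ty n) m} {A B t u} →
             Γ ⊢ t ∶ A → Γ ⊢ u ∶ B → Γ ⊢ snd (pair t u) ≐ u ∶ B
    η-pair : ∀ {n m} {Γ : Vec (Ty n) m} {A B t} →
             Γ ⊢ t ∶ A ⊠ B → Γ ⊢ t ≐ pair (fst t) (snd t) ∶ A ⊠ B
    η-unit : ∀ {n m} {Γ : Vec (Ty n) m} {t} →
             Γ ⊢ t ∶ unit → Γ ⊢ t ≐ unit ∶ unit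

open F public using (Ty; Tm; tv; _⟶_; all; _⊠_; _⊢_∶_; _⊢_≐_∶_)

-- Part 3. The CPS transform  (−)‾  from λ_eff into System F.
-- Types are closed, hence usable at any type-variable scope n.

mutual
  cpsV : ∀ {n} → VTy → Ty n
  cpsV 𝟙       = F.unit
  cpsV (A ⊗ B) = cpsV A ⊠ cpsV B
  cpsV (A ⇒ C) = cpsV A ⟶ cpsC C

  cpsC : ∀ {n} → CTy → Ty n
  cpsC (A ! S) = all ((cpsV A ⟶ tv zero) ⟶ (cpsH S (tv zero) ⟶ tv zero))

  -- H_Σ[β] = Π_op (A_op‾ × (B_op‾ → β) → β), as a nested binary product
  cpsH : ∀ {n} → Sig → Ty n → Ty n
  cpsH ∅           β = F.unit
  cpsH (S ▹ A ↦ B) β = cpsH S β ⊠ ((cpsV A ⊠ (cpsV B ⟶ β)) ⟶ β)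

len : Ctx → ℕ
len ε       = zero
len (Γ ▸ A) = suc (len Γ)

cpsCtx : ∀ {n} (Γ : Ctx) → Vec (Ty n) (len Γ)
cpsCtx ε       = []
cpsCtx (Γ ▸ A) = cpsV A ∷ cpsCtx Γ

toFin : Var Γ A → Fin (len Γ)
toFin vz     = zero
toFin (vs x) = suc (toFin x)

proj : ∀ {n m} → Op S A B → Tm n m → Tm n m
proj here      h = F.snd h
proj (there o) h = proj o (F.fst h)

wk₂ : ∀ {n m} → Tm n m → Tm n (suc (suc m))
wk₂ = F.renTm (λ i → suc (suc i))

-- substitution implementing the pattern λ⟨x,k⟩.M  as  λp.M[π₁ p/x, π₂ p/k]
σpat : ∀ {n m} → Fin (suc (suc m)) → Tm n (suc m)
σpat zero          = F.snd (F.var zero)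
σpat (suc zero)    = F.fst (F.var zero)
σpat (suc (suc i)) = F.var (suc i)

mutual
  cpsVal : ∀ {n} → Val Γ A → Tm n (len Γ)
  cpsVal (var x)            = F.var (toFin x)
  cpsVal tt                 = F.unit
  cpsVal (pair V W)         = F.pair (cpsVal V) (cpsVal W)
  cpsVal (fst V)            = F.fst (cpsVal V)
  cpsVal (snd V)            = F.snd (cpsVal V)
  cpsVal (lam {A = A} M)    = F.lam (cpsV A) (cpsComp M)

  cpsComp : ∀ {n} → Comp Γ C → Tm n (len Γ)
  cpsComp (app V W) = F.app (cpsVal V) (cpsVal W)
  -- Λβ.λk.λh. k V‾
  cpsComp (ret {A = A} {S = S} V) =
    F.Lam (F.lam (cpsV A ⟶ tv zero) (F.lam (cpsH S (tv zero))
      (F.app (F.var (suc zero)) (wk₂ (cpsVal V)))))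
  -- Λβ.λk.λh. M‾ β (λx. N‾ β k h) h
  cpsComp (`let {A = A} {S = S} {B = B} M N) =
    F.Lam (F.lam (cpsV B ⟶ tv zero) (F.lam (cpsH S (tv zero))
      (F.app (F.app (F.App (wk₂ (cpsComp M)) (tv zero))
                    (F.lam (cpsV A)
                      (F.app (F.app (F.App (F.renTm (F.extρ (λ i → suc (suc i))) (cpsComp N))
                                           (tv zero))
                                    (F.var (suc (suc zero))))
                             (F.var (suc zero)))))
             (F.var zero))))
  -- Λβ.λk.λh. π_op h ⟨V‾, k⟩
  cpsComp (perform {S = S} {B = B} o V) =
    F.Lam (F.lam (cpsV B ⟶ tv zero) (F.lam (cpsH S (tv zero))
      (F.app (proj o (F.var zero)) (F.pair (wk₂ (cpsVal V)) (F.var (suc zero))))))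
  cpsComp (handle {A = A} {C = C} M H N) =
    F.app (F.app (F.App (cpsComp M) (cpsC C)) (F.lam (cpsV A) (cpsComp N)))
          (cpsHand H)

  cpsHand : ∀ {n} → Handler Γ S C → Tm n (len Γ)
  cpsHand []                                  = F.unit
  cpsHand (_∷_ {C = C} {A = A} {B = B} H M) =
    F.pair (cpsHand H) (F.lam (cpsV A ⊠ (cpsV B ⟶ cpsC C)) (F.subTm σpat (cpsComp M)))

-- The translation is compositional and commutes with renaming and substitution of term
-- variables; as translated types are closed, translated terms are moreover invariant under
-- type renaming and substitution. So congruences and the β/η laws of λ_eff go over to those
-- of System F. The monad and handler laws rest on administrative β-reductions: applied to
-- an answer type β, a continuation k and a handler h, the translations of return V,
-- let x ⇐ M in N and op(V) reduce to k V‾, M‾ β (λx. N‾ β k h) h and π_op h ⟨V‾, k⟩. The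
-- handler laws are the instances β = C‾, k = λx.N‾, h = H‾; the let laws are compared under
-- Λβ.λk.λh, after η-expanding whichever side is not an abstraction. For the reduction of
-- op(V) under a handle-free context E, the continuation accumulated while running E[op(V)]
-- is the translation of λy. E[return y], so both sides reduce to M_op‾ with V‾ and the
-- translated resumption substituted for x and k.

module Submission where

open import Data.Nat using (suc)
open import Data.Fin using (Fin; zero; suc)
open import Data.Vec using (Vec; []; _∷_; lookup; map)
open import Data.Vec.Properties using (lookup-map; map-∘; map-cong; map-id)
open import Data.Product using (_×_; _,_)
open import Function using (id)
open import Relation.Binary.PropositionalEquality using (_≡_; refl; sym; trans; cong; cong₂)
open import Defs
open F

-- Renaming and substitution in System F

extρ-∘ : ∀ {n₁ n₂ n₃} {ρ : Fin n₂ → Fin n₃} {ρ' : Fin n₁ → Fin n₂} {ρ''} →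
  (∀ i → ρ (ρ' i) ≡ ρ'' i) → ∀ i → extρ ρ (extρ ρ' i) ≡ extρ ρ'' i
extρ-∘ e zero    = refl
extρ-∘ e (suc i) = cong suc (e i)

renTy-renTy : ∀ {n₁ n₂ n₃} {ρ : Fin n₂ → Fin n₃} {ρ' : Fin n₁ → Fin n₂} {ρ''} →
  (∀ i → ρ (ρ' i) ≡ ρ'' i) → ∀ A → renTy ρ (renTy ρ' A) ≡ renTy ρ'' A
renTy-renTy e (tv i)  = cong tv (e i)
renTy-renTy e (A ⟶ B) = cong₂ _⟶_ (renTy-renTy e A) (renTy-renTy e B)
renTy-renTy e (all A) = cong all (renTy-renTy (extρ-∘ e) A)
renTy-renTy e (A ⊠ B) = cong₂ _⊠_ (renTy-renTy e A) (renTy-renTy e B)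
renTy-renTy e unit    = refl

renTy-extρ-suc : ∀ {n n'} (ρ : Fin n → Fin n') A →
  renTy (extρ ρ) (renTy suc A) ≡ renTy suc (renTy ρ A)
renTy-extρ-suc ρ A = trans (renTy-renTy (λ _ → refl) A) (sym (renTy-renTy (λ _ → refl) A))

subTy-renTy : ∀ {n₁ n₂ n₃} {σ : Fin n₂ → Ty n₃} {ρ : Fin n₁ → Fin n₂} {σ'} →
  (∀ i → σ (ρ i) ≡ σ' i) → ∀ A → subTy σ (renTy ρ A) ≡ subTy σ' A
subTy-renTy e (tv i)  = e i
subTy-renTy e (A ⟶ B) = cong₂ _⟶_ (subTy-renTy e A) (subTy-renTy e B)
subTy-renTy {σ = σ} {ρ} {σ'} e (all A) = cong all (subTy-renTy e' A)
  where
  e' : ∀ i → extσT σ (extρ ρ i) ≡ extσT σ' i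
  e' zero    = refl
  e' (suc i) = cong (renTy suc) (e i)
subTy-renTy e (A ⊠ B) = cong₂ _⊠_ (subTy-renTy e A) (subTy-renTy e B)
subTy-renTy e unit    = refl

renTy-subTy : ∀ {n₁ n₂ n₃} {ρ : Fin n₂ → Fin n₃} {σ : Fin n₁ → Ty n₂} {σ'} →
  (∀ i → renTy ρ (σ i) ≡ σ' i) → ∀ A → renTy ρ (subTy σ A) ≡ subTy σ' A
renTy-subTy e (tv i)  = e i
renTy-subTy e (A ⟶ B) = cong₂ _⟶_ (renTy-subTy e A) (renTy-subTy e B)
renTy-subTy {ρ = ρ} {σ} {σ'} e (all A) = cong all (renTy-subTy e' A)
  where
  e' : ∀ i → renTy (extρ ρ) (extσT σ i) ≡ extσT σ' i
  e' zero    = refl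
  e' (suc i) = trans (renTy-extρ-suc ρ (σ i)) (cong (renTy suc) (e i))
renTy-subTy e (A ⊠ B) = cong₂ _⊠_ (renTy-subTy e A) (renTy-subTy e B)
renTy-subTy e unit    = refl

subTy-extσT-suc : ∀ {n n'} (σ : Fin n → Ty n') A →
  subTy (extσT σ) (renTy suc A) ≡ renTy suc (subTy σ A)
subTy-extσT-suc σ A = trans (subTy-renTy (λ _ → refl) A) (sym (renTy-subTy (λ _ → refl) A))

subTy-subTy : ∀ {n₁ n₂ n₃} {σ : Fin n₂ → Ty n₃} {σ' : Fin n₁ → Ty n₂} {σ''} →
  (∀ i → subTy σ (σ' i) ≡ σ'' i) → ∀ A → subTy σ (subTy σ' A) ≡ subTy σ'' A
subTy-subTy e (tv i)  = e i
subTy-subTy e (A ⟶ B) = cong₂ _⟶_ (subTy-subTy e A) (subTy-subTy e B)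
subTy-subTy {σ = σ} {σ'} {σ''} e (all A) = cong all (subTy-subTy e' A)
  where
  e' : ∀ i → subTy (extσT σ) (extσT σ' i) ≡ extσT σ'' i
  e' zero    = refl
  e' (suc i) = trans (subTy-extσT-suc σ (σ' i)) (cong (renTy suc) (e i))
subTy-subTy e (A ⊠ B) = cong₂ _⊠_ (subTy-subTy e A) (subTy-subTy e B)
subTy-subTy e unit    = refl

subTy-id : ∀ {n} {σ : Fin n → Ty n} → (∀ i → σ i ≡ tv i) → ∀ A → subTy σ A ≡ A
subTy-id e (tv i)  = e i
subTy-id e (A ⟶ B) = cong₂ _⟶_ (subTy-id e A) (subTy-id e B)
subTy-id {σ = σ} e (all A) = cong all (subTy-id e' A)
  where
  e' : ∀ i → extσT σ i ≡ tv i
  e' zero    = refl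
  e' (suc i) = cong (renTy suc) (e i)
subTy-id e (A ⊠ B) = cong₂ _⊠_ (subTy-id e A) (subTy-id e B)
subTy-id e unit    = refl

subTy-σT₀-suc : ∀ {n} (B : Ty n) A → subTy (σT₀ B) (renTy suc A) ≡ A
subTy-σT₀-suc B A = trans (subTy-renTy (λ _ → refl) A) (subTy-id (λ _ → refl) A)

tyRenTm-tyRenTm : ∀ {n₁ n₂ n₃ m} {ρ : Fin n₂ → Fin n₃} {ρ' : Fin n₁ → Fin n₂} {ρ''} →
  (∀ i → ρ (ρ' i) ≡ ρ'' i) → (t : Tm n₁ m) → tyRenTm ρ (tyRenTm ρ' t) ≡ tyRenTm ρ'' t
tyRenTm-tyRenTm e (var x)    = refl
tyRenTm-tyRenTm e (lam A t)  = cong₂ lam (renTy-renTy e A) (tyRenTm-tyRenTm e t)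
tyRenTm-tyRenTm e (app t u)  = cong₂ app (tyRenTm-tyRenTm e t) (tyRenTm-tyRenTm e u)
tyRenTm-tyRenTm e (Lam t)    = cong Lam (tyRenTm-tyRenTm (extρ-∘ e) t)
tyRenTm-tyRenTm e (App t B)  = cong₂ App (tyRenTm-tyRenTm e t) (renTy-renTy e B)
tyRenTm-tyRenTm e (pair t u) = cong₂ pair (tyRenTm-tyRenTm e t) (tyRenTm-tyRenTm e u)
tyRenTm-tyRenTm e (fst t)    = cong fst (tyRenTm-tyRenTm e t)
tyRenTm-tyRenTm e (snd t)    = cong snd (tyRenTm-tyRenTm e t)
tyRenTm-tyRenTm e unit       = refl

tyRenTm-extρ-suc : ∀ {n n' m} (ρ : Fin n → Fin n') (t : Tm n m) →
  tyRenTm (extρ ρ) (tyRenTm suc t) ≡ tyRenTm suc (tyRenTm ρ t)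
tyRenTm-extρ-suc ρ t = trans (tyRenTm-tyRenTm (λ _ → refl) t) (sym (tyRenTm-tyRenTm (λ _ → refl) t))

tySubTm-tyRenTm : ∀ {n₁ n₂ n₃ m} {σ : Fin n₂ → Ty n₃} {ρ : Fin n₁ → Fin n₂} {σ'} →
  (∀ i → σ (ρ i) ≡ σ' i) → (t : Tm n₁ m) → tySubTm σ (tyRenTm ρ t) ≡ tySubTm σ' t
tySubTm-tyRenTm e (var x)    = refl
tySubTm-tyRenTm e (lam A t)  = cong₂ lam (subTy-renTy e A) (tySubTm-tyRenTm e t)
tySubTm-tyRenTm e (app t u)  = cong₂ app (tySubTm-tyRenTm e t) (tySubTm-tyRenTm e u)
tySubTm-tyRenTm {σ = σ} {ρ} {σ'} e (Lam t) = cong Lam (tySubTm-tyRenTm e' t)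
  where
  e' : ∀ i → extσT σ (extρ ρ i) ≡ extσT σ' i
  e' zero    = refl
  e' (suc i) = cong (renTy suc) (e i)
tySubTm-tyRenTm e (App t B)  = cong₂ App (tySubTm-tyRenTm e t) (subTy-renTy e B)
tySubTm-tyRenTm e (pair t u) = cong₂ pair (tySubTm-tyRenTm e t) (tySubTm-tyRenTm e u)
tySubTm-tyRenTm e (fst t)    = cong fst (tySubTm-tyRenTm e t)
tySubTm-tyRenTm e (snd t)    = cong snd (tySubTm-tyRenTm e t)
tySubTm-tyRenTm e unit       = refl

tyRenTm-tySubTm : ∀ {n₁ n₂ n₃ m} {ρ : Fin n₂ → Fin n₃} {σ : Fin n₁ → Ty n₂} {σ'} →
  (∀ i → renTy ρ (σ i) ≡ σ' i) → (t : Tm n₁ m) → tyRenTm ρ (tySubTm σ t) ≡ tySubTm σ' t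
tyRenTm-tySubTm e (var x)    = refl
tyRenTm-tySubTm e (lam A t)  = cong₂ lam (renTy-subTy e A) (tyRenTm-tySubTm e t)
tyRenTm-tySubTm e (app t u)  = cong₂ app (tyRenTm-tySubTm e t) (tyRenTm-tySubTm e u)
tyRenTm-tySubTm {ρ = ρ} {σ} {σ'} e (Lam t) = cong Lam (tyRenTm-tySubTm e' t)
  where
  e' : ∀ i → renTy (extρ ρ) (extσT σ i) ≡ extσT σ' i
  e' zero    = refl
  e' (suc i) = trans (renTy-extρ-suc ρ (σ i)) (cong (renTy suc) (e i))
tyRenTm-tySubTm e (App t B)  = cong₂ App (tyRenTm-tySubTm e t) (renTy-subTy e B)
tyRenTm-tySubTm e (pair t u) = cong₂ pair (tyRenTm-tySubTm e t) (tyRenTm-tySubTm e u)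
tyRenTm-tySubTm e (fst t)    = cong fst (tyRenTm-tySubTm e t)
tyRenTm-tySubTm e (snd t)    = cong snd (tyRenTm-tySubTm e t)
tyRenTm-tySubTm e unit       = refl

tySubTm-extσT-suc : ∀ {n n' m} (σ : Fin n → Ty n') (t : Tm n m) →
  tySubTm (extσT σ) (tyRenTm suc t) ≡ tyRenTm suc (tySubTm σ t)
tySubTm-extσT-suc σ t = trans (tySubTm-tyRenTm (λ _ → refl) t) (sym (tyRenTm-tySubTm (λ _ → refl) t))

suc₂ : ∀ {m} → Fin m → Fin (suc (suc m))
suc₂ i = suc (suc i)

renTm-renTm : ∀ {n m₁ m₂ m₃} {ρ : Fin m₂ → Fin m₃} {ρ' : Fin m₁ → Fin m₂} {ρ''} →
  (∀ i → ρ (ρ' i) ≡ ρ'' i) → (t : Tm n m₁) → renTm ρ (renTm ρ' t) ≡ renTm ρ'' t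
renTm-renTm e (var x)    = cong var (e x)
renTm-renTm e (lam A t)  = cong (lam A) (renTm-renTm (extρ-∘ e) t)
renTm-renTm e (app t u)  = cong₂ app (renTm-renTm e t) (renTm-renTm e u)
renTm-renTm e (Lam t)    = cong Lam (renTm-renTm e t)
renTm-renTm e (App t B)  = cong (λ z → App z B) (renTm-renTm e t)
renTm-renTm e (pair t u) = cong₂ pair (renTm-renTm e t) (renTm-renTm e u)
renTm-renTm e (fst t)    = cong fst (renTm-renTm e t)
renTm-renTm e (snd t)    = cong snd (renTm-renTm e t)
renTm-renTm e unit       = refl

renTm-extρ-suc : ∀ {n m m'} (ρ : Fin m → Fin m') (t : Tm n m) →
  renTm (extρ ρ) (renTm suc t) ≡ renTm suc (renTm ρ t)
renTm-extρ-suc ρ t = trans (renTm-renTm (λ _ → refl) t) (sym (renTm-renTm (λ _ → refl) t))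

renTm-tyRenTm-comm : ∀ {n n' m m'} (ρ : Fin m → Fin m') (ρT : Fin n → Fin n') (t : Tm n m) →
  renTm ρ (tyRenTm ρT t) ≡ tyRenTm ρT (renTm ρ t)
renTm-tyRenTm-comm ρ ρT (var x)    = refl
renTm-tyRenTm-comm ρ ρT (lam A t)  = cong (lam _) (renTm-tyRenTm-comm (extρ ρ) ρT t)
renTm-tyRenTm-comm ρ ρT (app t u)  = cong₂ app (renTm-tyRenTm-comm ρ ρT t) (renTm-tyRenTm-comm ρ ρT u)
renTm-tyRenTm-comm ρ ρT (Lam t)    = cong Lam (renTm-tyRenTm-comm ρ (extρ ρT) t)
renTm-tyRenTm-comm ρ ρT (App t B)  = cong (λ z → App z _) (renTm-tyRenTm-comm ρ ρT t)
renTm-tyRenTm-comm ρ ρT (pair t u) = cong₂ pair (renTm-tyRenTm-comm ρ ρT t) (renTm-tyRenTm-comm ρ ρT u)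
renTm-tyRenTm-comm ρ ρT (fst t)    = cong fst (renTm-tyRenTm-comm ρ ρT t)
renTm-tyRenTm-comm ρ ρT (snd t)    = cong snd (renTm-tyRenTm-comm ρ ρT t)
renTm-tyRenTm-comm ρ ρT unit       = refl

renTm-tySubTm-comm : ∀ {n n' m m'} (ρ : Fin m → Fin m') (σT : Fin n → Ty n') (t : Tm n m) →
  renTm ρ (tySubTm σT t) ≡ tySubTm σT (renTm ρ t)
renTm-tySubTm-comm ρ σT (var x)    = refl
renTm-tySubTm-comm ρ σT (lam A t)  = cong (lam _) (renTm-tySubTm-comm (extρ ρ) σT t)
renTm-tySubTm-comm ρ σT (app t u)  = cong₂ app (renTm-tySubTm-comm ρ σT t) (renTm-tySubTm-comm ρ σT u)
renTm-tySubTm-comm ρ σT (Lam t)    = cong Lam (renTm-tySubTm-comm ρ (extσT σT) t)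
renTm-tySubTm-comm ρ σT (App t B)  = cong (λ z → App z _) (renTm-tySubTm-comm ρ σT t)
renTm-tySubTm-comm ρ σT (pair t u) = cong₂ pair (renTm-tySubTm-comm ρ σT t) (renTm-tySubTm-comm ρ σT u)
renTm-tySubTm-comm ρ σT (fst t)    = cong fst (renTm-tySubTm-comm ρ σT t)
renTm-tySubTm-comm ρ σT (snd t)    = cong snd (renTm-tySubTm-comm ρ σT t)
renTm-tySubTm-comm ρ σT unit       = refl

subTm-renTm : ∀ {n m₁ m₂ m₃} {σ : Fin m₂ → Tm n m₃} {ρ : Fin m₁ → Fin m₂} {σ'} →
  (∀ i → σ (ρ i) ≡ σ' i) → (t : Tm n m₁) → subTm σ (renTm ρ t) ≡ subTm σ' t
subTm-renTm e (var x)    = e x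
subTm-renTm {σ = σ} {ρ} {σ'} e (lam A t) = cong (lam A) (subTm-renTm e' t)
  where
  e' : ∀ i → extσ σ (extρ ρ i) ≡ extσ σ' i
  e' zero    = refl
  e' (suc i) = cong (renTm suc) (e i)
subTm-renTm e (app t u)  = cong₂ app (subTm-renTm e t) (subTm-renTm e u)
subTm-renTm e (Lam t)    = cong Lam (subTm-renTm (λ i → cong (tyRenTm suc) (e i)) t)
subTm-renTm e (App t B)  = cong (λ z → App z B) (subTm-renTm e t)
subTm-renTm e (pair t u) = cong₂ pair (subTm-renTm e t) (subTm-renTm e u)
subTm-renTm e (fst t)    = cong fst (subTm-renTm e t)
subTm-renTm e (snd t)    = cong snd (subTm-renTm e t)
subTm-renTm e unit       = refl

renTm-subTm : ∀ {n m₁ m₂ m₃} {ρ : Fin m₂ → Fin m₃} {σ : Fin m₁ → Tm n m₂} {σ'} →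
  (∀ i → renTm ρ (σ i) ≡ σ' i) → (t : Tm n m₁) → renTm ρ (subTm σ t) ≡ subTm σ' t
renTm-subTm e (var x)    = e x
renTm-subTm {ρ = ρ} {σ} {σ'} e (lam A t) = cong (lam A) (renTm-subTm e' t)
  where
  e' : ∀ i → renTm (extρ ρ) (extσ σ i) ≡ extσ σ' i
  e' zero    = refl
  e' (suc i) = trans (renTm-extρ-suc ρ (σ i)) (cong (renTm suc) (e i))
renTm-subTm e (app t u)  = cong₂ app (renTm-subTm e t) (renTm-subTm e u)
renTm-subTm {ρ = ρ} {σ} {σ'} e (Lam t) = cong Lam (renTm-subTm e' t)
  where
  e' : ∀ i → renTm ρ (tyRenTm suc (σ i)) ≡ tyRenTm suc (σ' i)
  e' i = trans (renTm-tyRenTm-comm ρ suc (σ i)) (cong (tyRenTm suc) (e i))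
renTm-subTm e (App t B)  = cong (λ z → App z B) (renTm-subTm e t)
renTm-subTm e (pair t u) = cong₂ pair (renTm-subTm e t) (renTm-subTm e u)
renTm-subTm e (fst t)    = cong fst (renTm-subTm e t)
renTm-subTm e (snd t)    = cong snd (renTm-subTm e t)
renTm-subTm e unit       = refl

subTm-extσ-suc : ∀ {n m m'} (σ : Fin m → Tm n m') (t : Tm n m) →
  subTm (extσ σ) (renTm suc t) ≡ renTm suc (subTm σ t)
subTm-extσ-suc σ t = trans (subTm-renTm (λ _ → refl) t) (sym (renTm-subTm (λ _ → refl) t))

tyRenTm-subTm-comm : ∀ {n n' m m'} {ρT : Fin n → Fin n'} {σ : Fin m → Tm n m'} {σ'} →
  (∀ i → tyRenTm ρT (σ i) ≡ σ' i) → (t : Tm n m) → tyRenTm ρT (subTm σ t) ≡ subTm σ' (tyRenTm ρT t)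
tyRenTm-subTm-comm e (var x)    = e x
tyRenTm-subTm-comm {ρT = ρT} {σ} {σ'} e (lam A t) = cong (lam _) (tyRenTm-subTm-comm e' t)
  where
  e' : ∀ i → tyRenTm ρT (extσ σ i) ≡ extσ σ' i
  e' zero    = refl
  e' (suc i) = trans (sym (renTm-tyRenTm-comm suc ρT (σ i))) (cong (renTm suc) (e i))
tyRenTm-subTm-comm e (app t u)  = cong₂ app (tyRenTm-subTm-comm e t) (tyRenTm-subTm-comm e u)
tyRenTm-subTm-comm {ρT = ρT} {σ} {σ'} e (Lam t) = cong Lam (tyRenTm-subTm-comm e' t)
  where
  e' : ∀ i → tyRenTm (extρ ρT) (tyRenTm suc (σ i)) ≡ tyRenTm suc (σ' i)
  e' i = trans (tyRenTm-extρ-suc ρT (σ i)) (cong (tyRenTm suc) (e i))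
tyRenTm-subTm-comm e (App t B)  = cong (λ z → App z _) (tyRenTm-subTm-comm e t)
tyRenTm-subTm-comm e (pair t u) = cong₂ pair (tyRenTm-subTm-comm e t) (tyRenTm-subTm-comm e u)
tyRenTm-subTm-comm e (fst t)    = cong fst (tyRenTm-subTm-comm e t)
tyRenTm-subTm-comm e (snd t)    = cong snd (tyRenTm-subTm-comm e t)
tyRenTm-subTm-comm e unit       = refl

tySubTm-subTm-comm : ∀ {n n' m m'} {σT : Fin n → Ty n'} {σ : Fin m → Tm n m'} {σ'} →
  (∀ i → tySubTm σT (σ i) ≡ σ' i) → (t : Tm n m) → tySubTm σT (subTm σ t) ≡ subTm σ' (tySubTm σT t)
tySubTm-subTm-comm e (var x)    = e x
tySubTm-subTm-comm {σT = σT} {σ} {σ'} e (lam A t) = cong (lam _) (tySubTm-subTm-comm e' t)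
  where
  e' : ∀ i → tySubTm σT (extσ σ i) ≡ extσ σ' i
  e' zero    = refl
  e' (suc i) = trans (sym (renTm-tySubTm-comm suc σT (σ i))) (cong (renTm suc) (e i))
tySubTm-subTm-comm e (app t u)  = cong₂ app (tySubTm-subTm-comm e t) (tySubTm-subTm-comm e u)
tySubTm-subTm-comm {σT = σT} {σ} {σ'} e (Lam t) = cong Lam (tySubTm-subTm-comm e' t)
  where
  e' : ∀ i → tySubTm (extσT σT) (tyRenTm suc (σ i)) ≡ tyRenTm suc (σ' i)
  e' i = trans (tySubTm-extσT-suc σT (σ i)) (cong (tyRenTm suc) (e i))
tySubTm-subTm-comm e (App t B)  = cong (λ z → App z _) (tySubTm-subTm-comm e t)
tySubTm-subTm-comm e (pair t u) = cong₂ pair (tySubTm-subTm-comm e t) (tySubTm-subTm-comm e u)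
tySubTm-subTm-comm e (fst t)    = cong fst (tySubTm-subTm-comm e t)
tySubTm-subTm-comm e (snd t)    = cong snd (tySubTm-subTm-comm e t)
tySubTm-subTm-comm e unit       = refl

subTm-subTm : ∀ {n m₁ m₂ m₃} {σ : Fin m₂ → Tm n m₃} {σ' : Fin m₁ → Tm n m₂} {σ''} →
  (∀ i → subTm σ (σ' i) ≡ σ'' i) → (t : Tm n m₁) → subTm σ (subTm σ' t) ≡ subTm σ'' t
subTm-subTm e (var x)    = e x
subTm-subTm {σ = σ} {σ'} {σ''} e (lam A t) = cong (lam A) (subTm-subTm e' t)
  where
  e' : ∀ i → subTm (extσ σ) (extσ σ' i) ≡ extσ σ'' i
  e' zero    = refl
  e' (suc i) = trans (subTm-extσ-suc σ (σ' i)) (cong (renTm suc) (e i))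
subTm-subTm {σ = σ} {σ'} {σ''} e (Lam t) = cong Lam (subTm-subTm e' t)
  where
  e' : ∀ i → subTm (λ j → tyRenTm suc (σ j)) (tyRenTm suc (σ' i)) ≡ tyRenTm suc (σ'' i)
  e' i = trans (sym (tyRenTm-subTm-comm (λ _ → refl) (σ' i))) (cong (tyRenTm suc) (e i))
subTm-subTm e (app t u)  = cong₂ app (subTm-subTm e t) (subTm-subTm e u)
subTm-subTm e (App t B)  = cong (λ z → App z B) (subTm-subTm e t)
subTm-subTm e (pair t u) = cong₂ pair (subTm-subTm e t) (subTm-subTm e u)
subTm-subTm e (fst t)    = cong fst (subTm-subTm e t)
subTm-subTm e (snd t)    = cong snd (subTm-subTm e t)
subTm-subTm e unit       = refl

subTm-id : ∀ {n m} {σ : Fin m → Tm n m} → (∀ i → σ i ≡ var i) → (t : Tm n m) → subTm σ t ≡ t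
subTm-id e (var x)    = e x
subTm-id {σ = σ} e (lam A t) = cong (lam A) (subTm-id e' t)
  where
  e' : ∀ i → extσ σ i ≡ var i
  e' zero    = refl
  e' (suc i) = cong (renTm suc) (e i)
subTm-id e (app t u)  = cong₂ app (subTm-id e t) (subTm-id e u)
subTm-id e (Lam t)    = cong Lam (subTm-id (λ i → cong (tyRenTm suc) (e i)) t)
subTm-id e (App t B)  = cong (λ z → App z B) (subTm-id e t)
subTm-id e (pair t u) = cong₂ pair (subTm-id e t) (subTm-id e u)
subTm-id e (fst t)    = cong fst (subTm-id e t)
subTm-id e (snd t)    = cong snd (subTm-id e t)
subTm-id e unit       = refl

subTm-var : ∀ {n m m'} {σ : Fin m → Tm n m'} {ρ} → (∀ i → σ i ≡ var (ρ i)) → (t : Tm n m) →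
  subTm σ t ≡ renTm ρ t
subTm-var {ρ = ρ} e t = trans (sym (subTm-renTm (λ i → sym (e i)) t)) (subTm-id (λ _ → refl) (renTm ρ t))

renTm-id : ∀ {n m} {ρ : Fin m → Fin m} → (∀ i → ρ i ≡ i) → (t : Tm n m) → renTm ρ t ≡ t
renTm-id e t = trans (sym (subTm-var (λ _ → refl) t)) (subTm-id (λ i → cong var (e i)) t)

-- Stability of typing and βη-equality

⊢-castTy : ∀ {n m} {Γ : Vec (Ty n) m} {t A B} → Γ ⊢ t ∶ A → A ≡ B → Γ ⊢ t ∶ B
⊢-castTy d refl = d

⊢-castCtx : ∀ {n m} {Γ Γ' : Vec (Ty n) m} {t A} → Γ ⊢ t ∶ A → Γ ≡ Γ' → Γ' ⊢ t ∶ A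
⊢-castCtx d refl = d

≐-castTy : ∀ {n m} {Γ : Vec (Ty n) m} {t u A B} → Γ ⊢ t ≐ u ∶ A → A ≡ B → Γ ⊢ t ≐ u ∶ B
≐-castTy d refl = d

≐-castˡ : ∀ {n m} {Γ : Vec (Ty n) m} {t t' u A} → Γ ⊢ t ≐ u ∶ A → t ≡ t' → Γ ⊢ t' ≐ u ∶ A
≐-castˡ d refl = d

≐-castʳ : ∀ {n m} {Γ : Vec (Ty n) m} {t u u' A} → Γ ⊢ t ≐ u ∶ A → u ≡ u' → Γ ⊢ t ≐ u' ∶ A
≐-castʳ d refl = d

⊢lam⁻¹ : ∀ {n m} {G : Vec (Ty n) m} {A B t} → G ⊢ lam A t ∶ A ⟶ B → (A ∷ G) ⊢ t ∶ B
⊢lam⁻¹ (⊢lam d) = d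

⊢Lam⁻¹ : ∀ {n m} {G : Vec (Ty n) m} {A t} → G ⊢ Lam t ∶ all A → map (renTy suc) G ⊢ t ∶ A
⊢Lam⁻¹ (⊢Lam d) = d

record TypedRen {n m m'} (Γ : Vec (Ty n) m) (Δ : Vec (Ty n) m') (ρ : Fin m → Fin m') : Set where
  constructor typedRen
  field lookup-ren : ∀ i → lookup Δ (ρ i) ≡ lookup Γ i
open TypedRen

typedRen-extρ : ∀ {n m m'} {Γ : Vec (Ty n) m} {Δ : Vec (Ty n) m'} {ρ} A →
  TypedRen Γ Δ ρ → TypedRen (A ∷ Γ) (A ∷ Δ) (extρ ρ)
typedRen-extρ A r = typedRen λ { zero → refl ; (suc i) → lookup-ren r i }

typedRen-map : ∀ {n n' m m'} {Γ : Vec (Ty n) m} {Δ : Vec (Ty n) m'} {ρ} (f : Ty n → Ty n') →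
  TypedRen Γ Δ ρ → TypedRen (map f Γ) (map f Δ) ρ
typedRen-map {Γ = Γ} {Δ} {ρ} f r = typedRen λ i →
  trans (lookup-map (ρ i) f Δ) (trans (cong f (lookup-ren r i)) (sym (lookup-map i f Γ)))

typedRen-suc : ∀ {n m} {Γ : Vec (Ty n) m} A → TypedRen Γ (A ∷ Γ) suc
typedRen-suc A = typedRen λ i → refl

⊢renTm : ∀ {n m m'} {Γ : Vec (Ty n) m} {Δ : Vec (Ty n) m'} {ρ t A} →
  TypedRen Γ Δ ρ → Γ ⊢ t ∶ A → Δ ⊢ renTm ρ t ∶ A
⊢renTm r (⊢var {x = x})    = ⊢-castTy ⊢var (lookup-ren r x)
⊢renTm r (⊢lam {A = A} d)  = ⊢lam (⊢renTm (typedRen-extρ A r) d)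
⊢renTm r (⊢app d e)        = ⊢app (⊢renTm r d) (⊢renTm r e)
⊢renTm r (⊢Lam d)          = ⊢Lam (⊢renTm (typedRen-map (renTy suc) r) d)
⊢renTm r (⊢App d)          = ⊢App (⊢renTm r d)
⊢renTm r (⊢pair d e)       = ⊢pair (⊢renTm r d) (⊢renTm r e)
⊢renTm r (⊢fst d)          = ⊢fst (⊢renTm r d)
⊢renTm r (⊢snd d)          = ⊢snd (⊢renTm r d)
⊢renTm r ⊢unit             = ⊢unit

map-renTy-extρ-suc : ∀ {n n' m} (ρ : Fin n → Fin n') (Γ : Vec (Ty n) m) →
  map (renTy (extρ ρ)) (map (renTy suc) Γ) ≡ map (renTy suc) (map (renTy ρ) Γ)
map-renTy-extρ-suc ρ Γ =
  trans (sym (map-∘ _ _ Γ)) (trans (map-cong (renTy-extρ-suc ρ) Γ) (map-∘ _ _ Γ))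

renTy-[]T : ∀ {n n'} (ρ : Fin n → Fin n') A B → renTy (extρ ρ) A [ renTy ρ B ]T ≡ renTy ρ (A [ B ]T)
renTy-[]T ρ A B = trans (subTy-renTy e₁ A) (sym (renTy-subTy e₂ A))
  where
  τ : Fin _ → Ty _
  τ zero    = renTy ρ B
  τ (suc i) = tv (ρ i)
  e₁ : ∀ i → σT₀ (renTy ρ B) (extρ ρ i) ≡ τ i
  e₁ zero    = refl
  e₁ (suc i) = refl
  e₂ : ∀ i → renTy ρ (σT₀ B i) ≡ τ i
  e₂ zero    = refl
  e₂ (suc i) = refl

⊢tyRenTm : ∀ {n n' m} {Γ : Vec (Ty n) m} {t A} (ρ : Fin n → Fin n') →
  Γ ⊢ t ∶ A → map (renTy ρ) Γ ⊢ tyRenTm ρ t ∶ renTy ρ A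
⊢tyRenTm {Γ = Γ} ρ (⊢var {x = x}) = ⊢-castTy ⊢var (lookup-map x (renTy ρ) Γ)
⊢tyRenTm ρ (⊢lam d)               = ⊢lam (⊢tyRenTm ρ d)
⊢tyRenTm ρ (⊢app d e)             = ⊢app (⊢tyRenTm ρ d) (⊢tyRenTm ρ e)
⊢tyRenTm {Γ = Γ} ρ (⊢Lam d)       = ⊢Lam (⊢-castCtx (⊢tyRenTm (extρ ρ) d) (map-renTy-extρ-suc ρ Γ))
⊢tyRenTm ρ (⊢App {A = A} {B = B} d) = ⊢-castTy (⊢App (⊢tyRenTm ρ d)) (renTy-[]T ρ A B)
⊢tyRenTm ρ (⊢pair d e)            = ⊢pair (⊢tyRenTm ρ d) (⊢tyRenTm ρ e)
⊢tyRenTm ρ (⊢fst d)               = ⊢fst (⊢tyRenTm ρ d)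
⊢tyRenTm ρ (⊢snd d)               = ⊢snd (⊢tyRenTm ρ d)
⊢tyRenTm ρ ⊢unit                  = ⊢unit

map-subTy-extσT-suc : ∀ {n n' m} (σ : Fin n → Ty n') (Γ : Vec (Ty n) m) →
  map (subTy (extσT σ)) (map (renTy suc) Γ) ≡ map (renTy suc) (map (subTy σ) Γ)
map-subTy-extσT-suc σ Γ =
  trans (sym (map-∘ _ _ Γ)) (trans (map-cong (subTy-extσT-suc σ) Γ) (map-∘ _ _ Γ))

subTy-[]T : ∀ {n n'} (σ : Fin n → Ty n') A B → subTy (extσT σ) A [ subTy σ B ]T ≡ subTy σ (A [ B ]T)
subTy-[]T σ A B = trans (subTy-subTy e₁ A) (sym (subTy-subTy e₂ A))
  where
  τ : Fin _ → Ty _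
  τ zero    = subTy σ B
  τ (suc i) = σ i
  e₁ : ∀ i → subTy (σT₀ (subTy σ B)) (extσT σ i) ≡ τ i
  e₁ zero    = refl
  e₁ (suc i) = subTy-σT₀-suc (subTy σ B) (σ i)
  e₂ : ∀ i → subTy σ (σT₀ B i) ≡ τ i
  e₂ zero    = refl
  e₂ (suc i) = refl

⊢tySubTm : ∀ {n n' m} {Γ : Vec (Ty n) m} {t A} (σ : Fin n → Ty n') →
  Γ ⊢ t ∶ A → map (subTy σ) Γ ⊢ tySubTm σ t ∶ subTy σ A
⊢tySubTm {Γ = Γ} σ (⊢var {x = x}) = ⊢-castTy ⊢var (lookup-map x (subTy σ) Γ)
⊢tySubTm σ (⊢lam d)               = ⊢lam (⊢tySubTm σ d)
⊢tySubTm σ (⊢app d e)             = ⊢app (⊢tySubTm σ d) (⊢tySubTm σ e)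
⊢tySubTm {Γ = Γ} σ (⊢Lam d)       = ⊢Lam (⊢-castCtx (⊢tySubTm (extσT σ) d) (map-subTy-extσT-suc σ Γ))
⊢tySubTm σ (⊢App {A = A} {B = B} d) = ⊢-castTy (⊢App (⊢tySubTm σ d)) (subTy-[]T σ A B)
⊢tySubTm σ (⊢pair d e)            = ⊢pair (⊢tySubTm σ d) (⊢tySubTm σ e)
⊢tySubTm σ (⊢fst d)               = ⊢fst (⊢tySubTm σ d)
⊢tySubTm σ (⊢snd d)               = ⊢snd (⊢tySubTm σ d)
⊢tySubTm σ ⊢unit                  = ⊢unit

record TypedSub {n m m'} (Γ : Vec (Ty n) m) (Δ : Vec (Ty n) m') (σ : Fin m → Tm n m') : Set where
  constructor typedSub
  field ⊢lookup-sub : ∀ i → Δ ⊢ σ i ∶ lookup Γ i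
open TypedSub

⊢subTm : ∀ {n m m'} {Γ : Vec (Ty n) m} {Δ : Vec (Ty n) m'} {σ t A} →
  TypedSub Γ Δ σ → Γ ⊢ t ∶ A → Δ ⊢ subTm σ t ∶ A
⊢subTm s (⊢var {x = x}) = ⊢lookup-sub s x
⊢subTm {Δ = Δ} {σ = σ} s (⊢lam {A = A} d) = ⊢lam (⊢subTm s' d)
  where
  s' : TypedSub (A ∷ _) (A ∷ Δ) (extσ σ)
  s' = typedSub λ { zero → ⊢var ; (suc i) → ⊢renTm (typedRen-suc A) (⊢lookup-sub s i) }
⊢subTm s (⊢app d e) = ⊢app (⊢subTm s d) (⊢subTm s e)
⊢subTm {Γ = Γ} {Δ} {σ} s (⊢Lam d) = ⊢Lam (⊢subTm s' d)
  where
  s' : TypedSub (map (renTy suc) Γ) (map (renTy suc) Δ) (λ i → tyRenTm suc (σ i))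
  s' = typedSub λ i → ⊢-castTy (⊢tyRenTm suc (⊢lookup-sub s i)) (sym (lookup-map i (renTy suc) Γ))
⊢subTm s (⊢App d)    = ⊢App (⊢subTm s d)
⊢subTm s (⊢pair d e) = ⊢pair (⊢subTm s d) (⊢subTm s e)
⊢subTm s (⊢fst d)    = ⊢fst (⊢subTm s d)
⊢subTm s (⊢snd d)    = ⊢snd (⊢subTm s d)
⊢subTm s ⊢unit       = ⊢unit

renTm-[]ᶠ : ∀ {n m m'} (ρ : Fin m → Fin m') (t : Tm n (suc m)) u →
  renTm (extρ ρ) t [ renTm ρ u ]ᶠ ≡ renTm ρ (t [ u ]ᶠ)
renTm-[]ᶠ ρ t u = trans (subTm-renTm e₁ t) (sym (renTm-subTm e₂ t))
  where
  τ : Fin _ → Tm _ _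
  τ zero    = renTm ρ u
  τ (suc i) = var (ρ i)
  e₁ : ∀ i → σ₀ (renTm ρ u) (extρ ρ i) ≡ τ i
  e₁ zero    = refl
  e₁ (suc i) = refl
  e₂ : ∀ i → renTm ρ (σ₀ u i) ≡ τ i
  e₂ zero    = refl
  e₂ (suc i) = refl

≐-renTm : ∀ {n m m'} {Γ : Vec (Ty n) m} {Δ : Vec (Ty n) m'} {ρ t u A} →
  TypedRen Γ Δ ρ → Γ ⊢ t ≐ u ∶ A → Δ ⊢ renTm ρ t ≐ renTm ρ u ∶ A
≐-renTm r (≐refl d)                = ≐refl (⊢renTm r d)
≐-renTm r (≐sym d)                 = ≐sym (≐-renTm r d)
≐-renTm r (≐trans d e)             = ≐trans (≐-renTm r d) (≐-renTm r e)
≐-renTm r (lam-cong {A = A} d)     = lam-cong (≐-renTm (typedRen-extρ A r) d)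
≐-renTm r (app-cong d e)           = app-cong (≐-renTm r d) (≐-renTm r e)
≐-renTm r (Lam-cong d)             = Lam-cong (≐-renTm (typedRen-map (renTy suc) r) d)
≐-renTm r (App-cong d)             = App-cong (≐-renTm r d)
≐-renTm r (pair-cong d e)          = pair-cong (≐-renTm r d) (≐-renTm r e)
≐-renTm r (fst-cong d)             = fst-cong (≐-renTm r d)
≐-renTm r (snd-cong d)             = snd-cong (≐-renTm r d)
≐-renTm {ρ = ρ} r (β-fun {A = A} {t = t} {u = u} d e) =
  ≐-castʳ (β-fun (⊢renTm (typedRen-extρ A r) d) (⊢renTm r e)) (renTm-[]ᶠ ρ t u)
≐-renTm {ρ = ρ} r (η-fun {t = t} d) =
  ≐-castʳ (η-fun (⊢renTm r d)) (cong (λ z → lam _ (app z (var zero))) (sym (renTm-extρ-suc ρ t)))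
≐-renTm {ρ = ρ} r (β-all {t = t} d) =
  ≐-castʳ (β-all (⊢renTm (typedRen-map (renTy suc) r) d)) (sym (renTm-tySubTm-comm ρ _ t))
≐-renTm {ρ = ρ} r (η-all {t = t} d) =
  ≐-castʳ (η-all (⊢renTm r d)) (cong (λ z → Lam (App z (tv zero))) (sym (renTm-tyRenTm-comm ρ suc t)))
≐-renTm r (β-fst d e)              = β-fst (⊢renTm r d) (⊢renTm r e)
≐-renTm r (β-snd d e)              = β-snd (⊢renTm r d) (⊢renTm r e)
≐-renTm r (η-pair d)               = η-pair (⊢renTm r d)
≐-renTm r (η-unit d)               = η-unit (⊢renTm r d)

-- Closedness of translated types

mutual
  renTy-cpsV : ∀ {n n'} (ρ : Fin n → Fin n') A → renTy ρ (cpsV A) ≡ cpsV A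
  renTy-cpsV ρ 𝟙       = refl
  renTy-cpsV ρ (A ⊗ B) = cong₂ _⊠_ (renTy-cpsV ρ A) (renTy-cpsV ρ B)
  renTy-cpsV ρ (A ⇒ C) = cong₂ _⟶_ (renTy-cpsV ρ A) (renTy-cpsC ρ C)

  renTy-cpsC : ∀ {n n'} (ρ : Fin n → Fin n') C → renTy ρ (cpsC C) ≡ cpsC C
  renTy-cpsC ρ (A ! S) rewrite renTy-cpsV (extρ ρ) A | renTy-cpsH (extρ ρ) S (tv zero) = refl

  renTy-cpsH : ∀ {n n'} (ρ : Fin n → Fin n') S β → renTy ρ (cpsH S β) ≡ cpsH S (renTy ρ β)
  renTy-cpsH ρ ∅           β = refl
  renTy-cpsH ρ (S ▹ A ↦ B) β rewrite renTy-cpsH ρ S β | renTy-cpsV ρ A | renTy-cpsV ρ B = refl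

mutual
  subTy-cpsV : ∀ {n n'} (σ : Fin n → Ty n') A → subTy σ (cpsV A) ≡ cpsV A
  subTy-cpsV σ 𝟙       = refl
  subTy-cpsV σ (A ⊗ B) = cong₂ _⊠_ (subTy-cpsV σ A) (subTy-cpsV σ B)
  subTy-cpsV σ (A ⇒ C) = cong₂ _⟶_ (subTy-cpsV σ A) (subTy-cpsC σ C)

  subTy-cpsC : ∀ {n n'} (σ : Fin n → Ty n') C → subTy σ (cpsC C) ≡ cpsC C
  subTy-cpsC σ (A ! S) rewrite subTy-cpsV (extσT σ) A | subTy-cpsH (extσT σ) S (tv zero) = refl

  subTy-cpsH : ∀ {n n'} (σ : Fin n → Ty n') S β → subTy σ (cpsH S β) ≡ cpsH S (subTy σ β)
  subTy-cpsH σ ∅           β = refl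
  subTy-cpsH σ (S ▹ A ↦ B) β rewrite subTy-cpsH σ S β | subTy-cpsV σ A | subTy-cpsV σ B = refl

map-renTy-cpsCtx : ∀ {n n'} (ρ : Fin n → Fin n') Γ → map (renTy ρ) (cpsCtx Γ) ≡ cpsCtx Γ
map-renTy-cpsCtx ρ ε       = refl
map-renTy-cpsCtx ρ (Γ ▸ A) = cong₂ _∷_ (renTy-cpsV ρ A) (map-renTy-cpsCtx ρ Γ)

cpsC-instance : ∀ {n} A S (B : Ty n) →
  ((cpsV A ⟶ tv zero) ⟶ (cpsH S (tv zero) ⟶ tv zero)) [ B ]T ≡ (cpsV A ⟶ B) ⟶ (cpsH S B ⟶ B)
cpsC-instance A S B rewrite subTy-cpsV (σT₀ B) A | subTy-cpsH (σT₀ B) S (tv zero) = refl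

tyRenTm-proj : ∀ {n n' m S A B} (ρ : Fin n → Fin n') (o : Op S A B) (t : Tm n m) →
  tyRenTm ρ (proj o t) ≡ proj o (tyRenTm ρ t)
tyRenTm-proj ρ here      t = refl
tyRenTm-proj ρ (there o) t = tyRenTm-proj ρ o (fst t)

tySubTm-proj : ∀ {n n' m S A B} (σ : Fin n → Ty n') (o : Op S A B) (t : Tm n m) →
  tySubTm σ (proj o t) ≡ proj o (tySubTm σ t)
tySubTm-proj σ here      t = refl
tySubTm-proj σ (there o) t = tySubTm-proj σ o (fst t)

renTm-proj : ∀ {n m m' S A B} (ρ : Fin m → Fin m') (o : Op S A B) (t : Tm n m) →
  renTm ρ (proj o t) ≡ proj o (renTm ρ t)
renTm-proj ρ here      t = refl
renTm-proj ρ (there o) t = renTm-proj ρ o (fst t)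

subTm-proj : ∀ {n m m' S A B} (σ : Fin m → Tm n m') (o : Op S A B) (t : Tm n m) →
  subTm σ (proj o t) ≡ proj o (subTm σ t)
subTm-proj σ here      t = refl
subTm-proj σ (there o) t = subTm-proj σ o (fst t)

tyRenTm-σpat : ∀ {n n' m} (ρ : Fin n → Fin n') (i : Fin (suc (suc m))) → tyRenTm ρ (σpat i) ≡ σpat i
tyRenTm-σpat ρ zero          = refl
tyRenTm-σpat ρ (suc zero)    = refl
tyRenTm-σpat ρ (suc (suc i)) = refl

tySubTm-σpat : ∀ {n n' m} (σ : Fin n → Ty n') (i : Fin (suc (suc m))) → tySubTm σ (σpat i) ≡ σpat i
tySubTm-σpat σ zero          = refl
tySubTm-σpat σ (suc zero)    = refl
tySubTm-σpat σ (suc (suc i)) = refl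

mutual
  tyRenTm-cpsVal : ∀ {Γ A n n'} (ρ : Fin n → Fin n') (V : Val Γ A) →
    tyRenTm ρ (cpsVal {n = n} V) ≡ cpsVal {n = n'} V
  tyRenTm-cpsVal ρ (var x)         = refl
  tyRenTm-cpsVal ρ tt              = refl
  tyRenTm-cpsVal ρ (pair V W)      = cong₂ pair (tyRenTm-cpsVal ρ V) (tyRenTm-cpsVal ρ W)
  tyRenTm-cpsVal ρ (fst V)         = cong fst (tyRenTm-cpsVal ρ V)
  tyRenTm-cpsVal ρ (snd V)         = cong snd (tyRenTm-cpsVal ρ V)
  tyRenTm-cpsVal ρ (lam {A = A} M) = cong₂ lam (renTy-cpsV ρ A) (tyRenTm-cpsComp ρ M)

  tyRenTm-cpsComp : ∀ {Γ C n n'} (ρ : Fin n → Fin n') (M : Comp Γ C) →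
    tyRenTm ρ (cpsComp {n = n} M) ≡ cpsComp {n = n'} M
  tyRenTm-cpsComp ρ (app V W) = cong₂ app (tyRenTm-cpsVal ρ V) (tyRenTm-cpsVal ρ W)
  tyRenTm-cpsComp ρ (ret {A = A} {S = S} V)
    rewrite renTy-cpsV (extρ ρ) A | renTy-cpsH (extρ ρ) S (tv zero)
          | sym (renTm-tyRenTm-comm suc₂ (extρ ρ) (cpsVal V)) | tyRenTm-cpsVal (extρ ρ) V = refl
  tyRenTm-cpsComp ρ (`let {A = A} {S = S} {B = B} M N)
    rewrite renTy-cpsV (extρ ρ) A | renTy-cpsV (extρ ρ) B | renTy-cpsH (extρ ρ) S (tv zero)
          | sym (renTm-tyRenTm-comm suc₂ (extρ ρ) (cpsComp M)) | tyRenTm-cpsComp (extρ ρ) M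
          | sym (renTm-tyRenTm-comm (extρ suc₂) (extρ ρ) (cpsComp N))
          | tyRenTm-cpsComp (extρ ρ) N = refl
  tyRenTm-cpsComp ρ (perform {S = S} {B = B} o V)
    rewrite renTy-cpsV (extρ ρ) B | renTy-cpsH (extρ ρ) S (tv zero)
          | sym (renTm-tyRenTm-comm suc₂ (extρ ρ) (cpsVal V)) | tyRenTm-cpsVal (extρ ρ) V =
    cong (λ z → Lam (lam _ (lam _ (app z (pair (wk₂ (cpsVal V)) (var (suc zero)))))))
         (tyRenTm-proj (extρ ρ) o (var zero))
  tyRenTm-cpsComp ρ (handle {A = A} {C = C} M H N)
    rewrite tyRenTm-cpsComp ρ M | renTy-cpsC ρ C | renTy-cpsV ρ A | tyRenTm-cpsComp ρ N
          | tyRenTm-cpsHand ρ H = refl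

  tyRenTm-cpsHand : ∀ {Γ S C n n'} (ρ : Fin n → Fin n') (H : Handler Γ S C) →
    tyRenTm ρ (cpsHand {n = n} H) ≡ cpsHand {n = n'} H
  tyRenTm-cpsHand ρ [] = refl
  tyRenTm-cpsHand ρ (_∷_ {C = C} {A = A} {B = B} H M)
    rewrite tyRenTm-cpsHand ρ H | renTy-cpsV ρ A | renTy-cpsV ρ B | renTy-cpsC ρ C
          | tyRenTm-subTm-comm {ρT = ρ} {σ = σpat} {σ' = σpat} (tyRenTm-σpat ρ) (cpsComp M)
          | tyRenTm-cpsComp ρ M = refl

mutual
  tySubTm-cpsVal : ∀ {Γ A n n'} (σ : Fin n → Ty n') (V : Val Γ A) →
    tySubTm σ (cpsVal {n = n} V) ≡ cpsVal {n = n'} V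
  tySubTm-cpsVal σ (var x)         = refl
  tySubTm-cpsVal σ tt              = refl
  tySubTm-cpsVal σ (pair V W)      = cong₂ pair (tySubTm-cpsVal σ V) (tySubTm-cpsVal σ W)
  tySubTm-cpsVal σ (fst V)         = cong fst (tySubTm-cpsVal σ V)
  tySubTm-cpsVal σ (snd V)         = cong snd (tySubTm-cpsVal σ V)
  tySubTm-cpsVal σ (lam {A = A} M) = cong₂ lam (subTy-cpsV σ A) (tySubTm-cpsComp σ M)

  tySubTm-cpsComp : ∀ {Γ C n n'} (σ : Fin n → Ty n') (M : Comp Γ C) →
    tySubTm σ (cpsComp {n = n} M) ≡ cpsComp {n = n'} M
  tySubTm-cpsComp σ (app V W) = cong₂ app (tySubTm-cpsVal σ V) (tySubTm-cpsVal σ W)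
  tySubTm-cpsComp σ (ret {A = A} {S = S} V)
    rewrite subTy-cpsV (extσT σ) A | subTy-cpsH (extσT σ) S (tv zero)
          | sym (renTm-tySubTm-comm suc₂ (extσT σ) (cpsVal V)) | tySubTm-cpsVal (extσT σ) V = refl
  tySubTm-cpsComp σ (`let {A = A} {S = S} {B = B} M N)
    rewrite subTy-cpsV (extσT σ) A | subTy-cpsV (extσT σ) B | subTy-cpsH (extσT σ) S (tv zero)
          | sym (renTm-tySubTm-comm suc₂ (extσT σ) (cpsComp M)) | tySubTm-cpsComp (extσT σ) M
          | sym (renTm-tySubTm-comm (extρ suc₂) (extσT σ) (cpsComp N))
          | tySubTm-cpsComp (extσT σ) N = refl
  tySubTm-cpsComp σ (perform {S = S} {B = B} o V)
    rewrite subTy-cpsV (extσT σ) B | subTy-cpsH (extσT σ) S (tv zero)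
          | sym (renTm-tySubTm-comm suc₂ (extσT σ) (cpsVal V)) | tySubTm-cpsVal (extσT σ) V =
    cong (λ z → Lam (lam _ (lam _ (app z (pair (wk₂ (cpsVal V)) (var (suc zero)))))))
         (tySubTm-proj (extσT σ) o (var zero))
  tySubTm-cpsComp σ (handle {A = A} {C = C} M H N)
    rewrite tySubTm-cpsComp σ M | subTy-cpsC σ C | subTy-cpsV σ A | tySubTm-cpsComp σ N
          | tySubTm-cpsHand σ H = refl

  tySubTm-cpsHand : ∀ {Γ S C n n'} (σ : Fin n → Ty n') (H : Handler Γ S C) →
    tySubTm σ (cpsHand {n = n} H) ≡ cpsHand {n = n'} H
  tySubTm-cpsHand σ [] = refl
  tySubTm-cpsHand σ (_∷_ {C = C} {A = A} {B = B} H M)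
    rewrite tySubTm-cpsHand σ H | subTy-cpsV σ A | subTy-cpsV σ B | subTy-cpsC σ C
          | tySubTm-subTm-comm {σT = σ} {σ = σpat} {σ' = σpat} (tySubTm-σpat σ) (cpsComp M)
          | tySubTm-cpsComp σ M = refl

-- The translation versus renaming and substitution

renTm-wk₂ : ∀ {n m m'} (ρ : Fin m → Fin m') (t : Tm n m) →
  renTm (extρ (extρ ρ)) (wk₂ t) ≡ wk₂ (renTm ρ t)
renTm-wk₂ ρ t = trans (renTm-renTm (λ _ → refl) t) (sym (renTm-renTm (λ _ → refl) t))

renTm-extρ-suc₂ : ∀ {n m m'} (ρ : Fin m → Fin m') (t : Tm n (suc m)) →
  renTm (extρ (extρ (extρ ρ))) (renTm (extρ suc₂) t) ≡ renTm (extρ suc₂) (renTm (extρ ρ) t)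
renTm-extρ-suc₂ ρ t = trans (renTm-renTm e₁ t) (sym (renTm-renTm e₂ t))
  where
  τ : Fin _ → Fin _
  τ zero    = zero
  τ (suc i) = suc (suc (suc (ρ i)))
  e₁ : ∀ i → extρ (extρ (extρ ρ)) (extρ suc₂ i) ≡ τ i
  e₁ zero    = refl
  e₁ (suc i) = refl
  e₂ : ∀ i → extρ suc₂ (extρ ρ i) ≡ τ i
  e₂ zero    = refl
  e₂ (suc i) = refl

renTm-σpat : ∀ {n m m'} (ρ : Fin m → Fin m') (t : Tm n (suc (suc m))) →
  renTm (extρ ρ) (subTm σpat t) ≡ subTm σpat (renTm (extρ (extρ ρ)) t)
renTm-σpat ρ t = trans (renTm-subTm e t) (sym (subTm-renTm (λ _ → refl) t))
  where
  e : ∀ i → renTm (extρ ρ) (σpat i) ≡ σpat (extρ (extρ ρ) i)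
  e zero          = refl
  e (suc zero)    = refl
  e (suc (suc i)) = refl

record CpsRen {Γ Δ : Ctx} (ρ : Ren Γ Δ) (ρ' : Fin (len Γ) → Fin (len Δ)) : Set where
  constructor cpsRen
  field toFin-ren : ∀ {A} (x : Var Γ A) → toFin (ρ x) ≡ ρ' (toFin x)
open CpsRen

cpsRen-ext : ∀ {Γ Δ A} {ρ : Ren Γ Δ} {ρ'} → CpsRen ρ ρ' → CpsRen (extR {A = A} ρ) (extρ ρ')
cpsRen-ext r = cpsRen λ { vz → refl ; (vs x) → cong suc (toFin-ren r x) }

cpsRen-vs : ∀ {Γ A} → CpsRen {Γ} {Γ ▸ A} vs suc
cpsRen-vs = cpsRen λ x → refl

mutual
  cpsVal-renV : ∀ {n Γ Δ A} {ρ : Ren Γ Δ} {ρ'} → CpsRen ρ ρ' → (V : Val Γ A) →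
    cpsVal {n = n} (renV ρ V) ≡ renTm ρ' (cpsVal V)
  cpsVal-renV r (var x)    = cong var (toFin-ren r x)
  cpsVal-renV r tt         = refl
  cpsVal-renV r (pair V W) = cong₂ pair (cpsVal-renV r V) (cpsVal-renV r W)
  cpsVal-renV r (fst V)    = cong fst (cpsVal-renV r V)
  cpsVal-renV r (snd V)    = cong snd (cpsVal-renV r V)
  cpsVal-renV r (lam M)    = cong (lam _) (cpsComp-renC (cpsRen-ext r) M)

  cpsComp-renC : ∀ {n Γ Δ C} {ρ : Ren Γ Δ} {ρ'} → CpsRen ρ ρ' → (M : Comp Γ C) →
    cpsComp {n = n} (renC ρ M) ≡ renTm ρ' (cpsComp M)
  cpsComp-renC r (app V W) = cong₂ app (cpsVal-renV r V) (cpsVal-renV r W)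
  cpsComp-renC {ρ' = ρ'} r (ret V) =
    cong (λ z → Lam (lam _ (lam _ (app (var (suc zero)) z))))
         (trans (cong wk₂ (cpsVal-renV r V)) (sym (renTm-wk₂ ρ' (cpsVal V))))
  cpsComp-renC {ρ' = ρ'} r (`let M N) =
    cong₂ (λ z w → Lam (lam _ (lam _ (app (app (App z (tv zero))
                                               (lam _ (app (app (App w (tv zero)) (var (suc (suc zero))))
                                                           (var (suc zero)))))
                                          (var zero)))))
          (trans (cong wk₂ (cpsComp-renC r M)) (sym (renTm-wk₂ ρ' (cpsComp M))))
          (trans (cong (renTm (extρ suc₂)) (cpsComp-renC (cpsRen-ext r) N))
                 (sym (renTm-extρ-suc₂ ρ' (cpsComp N))))
  cpsComp-renC {ρ' = ρ'} r (perform o V) =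
    cong₂ (λ z w → Lam (lam _ (lam _ (app z (pair w (var (suc zero)))))))
          (sym (renTm-proj (extρ (extρ ρ')) o (var zero)))
          (trans (cong wk₂ (cpsVal-renV r V)) (sym (renTm-wk₂ ρ' (cpsVal V))))
  cpsComp-renC r (handle M H N) =
    cong₂ app (cong₂ app (cong (λ z → App z _) (cpsComp-renC r M)) (cong (lam _) (cpsComp-renC (cpsRen-ext r) N)))
              (cpsHand-renH r H)

  cpsHand-renH : ∀ {n Γ Δ S C} {ρ : Ren Γ Δ} {ρ'} → CpsRen ρ ρ' → (H : Handler Γ S C) →
    cpsHand {n = n} (renH ρ H) ≡ renTm ρ' (cpsHand H)
  cpsHand-renH r [] = refl
  cpsHand-renH {ρ' = ρ'} r (H ∷ M) =
    cong₂ pair (cpsHand-renH r H)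
               (cong (lam _) (trans (cong (subTm σpat) (cpsComp-renC (cpsRen-ext (cpsRen-ext r)) M))
                                    (sym (renTm-σpat ρ' (cpsComp M)))))

cpsVal-wkV : ∀ {n Γ A B} (V : Val Γ A) → cpsVal {n = n} (renV (vs {B = B}) V) ≡ renTm suc (cpsVal V)
cpsVal-wkV V = cpsVal-renV cpsRen-vs V

subTm-wk₂ : ∀ {n m m'} (τ : Fin m → Tm n m') (t : Tm n m) →
  subTm (extσ (extσ τ)) (wk₂ t) ≡ wk₂ (subTm τ t)
subTm-wk₂ τ t =
  trans (subTm-renTm (λ i → renTm-renTm (λ _ → refl) (τ i)) t) (sym (renTm-subTm (λ _ → refl) t))

subTm-extρ-suc₂ : ∀ {n m m'} (τ : Fin m → Tm n m') (t : Tm n (suc m)) →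
  subTm (extσ (extσ (extσ τ))) (renTm (extρ suc₂) t) ≡ renTm (extρ suc₂) (subTm (extσ τ) t)
subTm-extρ-suc₂ τ t = trans (subTm-renTm e₁ t) (sym (renTm-subTm e₂ t))
  where
  τ' : Fin _ → Tm _ _
  τ' zero    = var zero
  τ' (suc i) = renTm (λ j → suc (suc (suc j))) (τ i)
  e₁ : ∀ i → extσ (extσ (extσ τ)) (extρ suc₂ i) ≡ τ' i
  e₁ zero    = refl
  e₁ (suc i) = trans (cong (renTm suc) (renTm-renTm (λ _ → refl) (τ i))) (renTm-renTm (λ _ → refl) (τ i))
  e₂ : ∀ i → renTm (extρ suc₂) (extσ τ i) ≡ τ' i
  e₂ zero    = refl
  e₂ (suc i) = renTm-renTm (λ _ → refl) (τ i)

subTm-σpat : ∀ {n m m'} (τ : Fin m → Tm n m') (t : Tm n (suc (suc m))) →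
  subTm (extσ τ) (subTm σpat t) ≡ subTm σpat (subTm (extσ (extσ τ)) t)
subTm-σpat τ t = trans (subTm-subTm e₁ t) (sym (subTm-subTm e₂ t))
  where
  τ' : Fin _ → Tm _ _
  τ' zero          = snd (var zero)
  τ' (suc zero)    = fst (var zero)
  τ' (suc (suc i)) = renTm suc (τ i)
  e₁ : ∀ i → subTm (extσ τ) (σpat i) ≡ τ' i
  e₁ zero          = refl
  e₁ (suc zero)    = refl
  e₁ (suc (suc i)) = refl
  e₂ : ∀ i → subTm σpat (extσ (extσ τ) i) ≡ τ' i
  e₂ zero          = refl
  e₂ (suc zero)    = refl
  e₂ (suc (suc i)) = trans (subTm-renTm (λ _ → refl) (renTm suc (τ i)))
                           (trans (subTm-renTm (λ _ → refl) (τ i)) (subTm-var (λ _ → refl) (τ i)))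

record CpsSub {n} {Γ Δ : Ctx} (σ : Sub Γ Δ) (τ : Fin (len Γ) → Tm n (len Δ)) : Set where
  constructor cpsSub
  field toFin-sub : ∀ {A} (x : Var Γ A) → τ (toFin x) ≡ cpsVal (σ x)
open CpsSub

cpsSub-ext : ∀ {n Γ Δ A} {σ : Sub Γ Δ} {τ : Fin (len Γ) → Tm n (len Δ)} →
  CpsSub σ τ → CpsSub (extS {A = A} σ) (extσ τ)
cpsSub-ext {σ = σ} s =
  cpsSub λ { vz → refl ; (vs x) → trans (cong (renTm suc) (toFin-sub s x)) (sym (cpsVal-wkV (σ x))) }

cpsSub-tyRenTm : ∀ {n Γ Δ} {σ : Sub Γ Δ} {τ : Fin (len Γ) → Tm n (len Δ)} →
  CpsSub σ τ → CpsSub σ (λ i → tyRenTm suc (τ i))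
cpsSub-tyRenTm {σ = σ} s =
  cpsSub λ x → trans (cong (tyRenTm suc) (toFin-sub s x)) (tyRenTm-cpsVal suc (σ x))

mutual
  cpsVal-subV : ∀ {n Γ Δ A} {σ : Sub Γ Δ} {τ : Fin (len Γ) → Tm n (len Δ)} → CpsSub σ τ →
    (V : Val Γ A) → cpsVal (subV σ V) ≡ subTm τ (cpsVal V)
  cpsVal-subV s (var x)    = sym (toFin-sub s x)
  cpsVal-subV s tt         = refl
  cpsVal-subV s (pair V W) = cong₂ pair (cpsVal-subV s V) (cpsVal-subV s W)
  cpsVal-subV s (fst V)    = cong fst (cpsVal-subV s V)
  cpsVal-subV s (snd V)    = cong snd (cpsVal-subV s V)
  cpsVal-subV s (lam M)    = cong (lam _) (cpsComp-subC (cpsSub-ext s) M)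

  cpsComp-subC : ∀ {n Γ Δ C} {σ : Sub Γ Δ} {τ : Fin (len Γ) → Tm n (len Δ)} → CpsSub σ τ →
    (M : Comp Γ C) → cpsComp (subC σ M) ≡ subTm τ (cpsComp M)
  cpsComp-subC s (app V W) = cong₂ app (cpsVal-subV s V) (cpsVal-subV s W)
  cpsComp-subC s (ret V) =
    cong (λ z → Lam (lam _ (lam _ (app (var (suc zero)) z))))
         (trans (cong wk₂ (cpsVal-subV (cpsSub-tyRenTm s) V)) (sym (subTm-wk₂ _ (cpsVal V))))
  cpsComp-subC s (`let M N) =
    cong₂ (λ z w → Lam (lam _ (lam _ (app (app (App z (tv zero))
                                               (lam _ (app (app (App w (tv zero)) (var (suc (suc zero))))
                                                           (var (suc zero)))))
                                          (var zero)))))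
          (trans (cong wk₂ (cpsComp-subC (cpsSub-tyRenTm s) M)) (sym (subTm-wk₂ _ (cpsComp M))))
          (trans (cong (renTm (extρ suc₂)) (cpsComp-subC (cpsSub-ext (cpsSub-tyRenTm s)) N))
                 (sym (subTm-extρ-suc₂ _ (cpsComp N))))
  cpsComp-subC {τ = τ} s (perform o V) =
    cong₂ (λ z w → Lam (lam _ (lam _ (app z (pair w (var (suc zero)))))))
          (sym (subTm-proj (extσ (extσ (λ i → tyRenTm suc (τ i)))) o (var zero)))
          (trans (cong wk₂ (cpsVal-subV (cpsSub-tyRenTm s) V)) (sym (subTm-wk₂ _ (cpsVal V))))
  cpsComp-subC s (handle M H N) =
    cong₂ app (cong₂ app (cong (λ z → App z _) (cpsComp-subC s M)) (cong (lam _) (cpsComp-subC (cpsSub-ext s) N)))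
              (cpsHand-subH s H)

  cpsHand-subH : ∀ {n Γ Δ S C} {σ : Sub Γ Δ} {τ : Fin (len Γ) → Tm n (len Δ)} → CpsSub σ τ →
    (H : Handler Γ S C) → cpsHand (subH σ H) ≡ subTm τ (cpsHand H)
  cpsHand-subH s [] = refl
  cpsHand-subH {τ = τ} s (H ∷ M) =
    cong₂ pair (cpsHand-subH s H)
               (cong (lam _) (trans (cong (subTm σpat) (cpsComp-subC (cpsSub-ext (cpsSub-ext s)) M))
                                    (sym (subTm-σpat τ (cpsComp M)))))

-- Typing of the translation

run : ∀ {n m} → Tm n m → Ty n → Tm n m → Tm n m → Tm n m
run t B k h = app (app (App t B) k) h

contTy : ∀ {n} → VTy → Ty (suc n)
contTy A = cpsV A ⟶ tv zero

handlerTy : ∀ {n} → Sig → Ty (suc n)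
handlerTy S = cpsH S (tv zero)

lookup-cpsCtx : ∀ {n Γ A} (x : Var Γ A) → lookup (cpsCtx {n} Γ) (toFin x) ≡ cpsV A
lookup-cpsCtx vz     = refl
lookup-cpsCtx (vs x) = lookup-cpsCtx x

⊢proj : ∀ {n m S A B} {Γ : Vec (Ty n) m} {t β} (o : Op S A B) →
  Γ ⊢ t ∶ cpsH S β → Γ ⊢ proj o t ∶ (cpsV A ⊠ (cpsV B ⟶ β)) ⟶ β
⊢proj here      d = ⊢snd d
⊢proj (there o) d = ⊢proj o (⊢fst d)

typedRen-underΛ : ∀ {n} Γ {X Y} →
  TypedRen (cpsCtx {suc n} Γ) (X ∷ Y ∷ map (renTy suc) (cpsCtx {n} Γ)) suc₂
typedRen-underΛ Γ = typedRen λ i → cong (λ v → lookup v i) (map-renTy-cpsCtx suc Γ)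

typedSub-σpat : ∀ {n m} {Γ : Vec (Ty n) m} {A B} → TypedSub (B ∷ A ∷ Γ) ((A ⊠ B) ∷ Γ) σpat
typedSub-σpat = typedSub λ { zero → ⊢snd ⊢var ; (suc zero) → ⊢fst ⊢var ; (suc (suc i)) → ⊢var }

⊢App-cpsC : ∀ {n m} {G : Vec (Ty n) m} {A S t B} →
  G ⊢ t ∶ cpsC (A ! S) → G ⊢ App t B ∶ (cpsV A ⟶ B) ⟶ (cpsH S B ⟶ B)
⊢App-cpsC {A = A} {S} {B = B} d = ⊢-castTy (⊢App d) (cpsC-instance A S B)

App-cpsC-cong : ∀ {n m} {G : Vec (Ty n) m} {A S t t' B} →
  G ⊢ t ≐ t' ∶ cpsC (A ! S) → G ⊢ App t B ≐ App t' B ∶ (cpsV A ⟶ B) ⟶ (cpsH S B ⟶ B)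
App-cpsC-cong {A = A} {S} {B = B} d = ≐-castTy (App-cong d) (cpsC-instance A S B)

mutual
  ⊢cpsVal : ∀ {n Γ A} (V : Val Γ A) → cpsCtx {n} Γ ⊢ cpsVal V ∶ cpsV A
  ⊢cpsVal (var x)    = ⊢-castTy ⊢var (lookup-cpsCtx x)
  ⊢cpsVal tt         = ⊢unit
  ⊢cpsVal (pair V W) = ⊢pair (⊢cpsVal V) (⊢cpsVal W)
  ⊢cpsVal (fst V)    = ⊢fst (⊢cpsVal V)
  ⊢cpsVal (snd V)    = ⊢snd (⊢cpsVal V)
  ⊢cpsVal (lam M)    = ⊢lam (⊢cpsComp M)

  ⊢cpsComp : ∀ {n Γ C} (M : Comp Γ C) → cpsCtx {n} Γ ⊢ cpsComp M ∶ cpsC C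
  ⊢cpsComp (app V W) = ⊢app (⊢cpsVal V) (⊢cpsVal W)
  ⊢cpsComp {Γ = Γ} (ret V) = ⊢Lam (⊢lam (⊢lam (⊢app ⊢var (⊢renTm (typedRen-underΛ Γ) (⊢cpsVal V)))))
  ⊢cpsComp {Γ = Γ} (`let M N) =
    ⊢Lam (⊢lam (⊢lam (⊢app (⊢app (⊢App-cpsC (⊢renTm (typedRen-underΛ Γ) (⊢cpsComp M)))
                                 (⊢let-continuation N))
                           ⊢var)))
  ⊢cpsComp {Γ = Γ} (perform o V) =
    ⊢Lam (⊢lam (⊢lam (⊢app (⊢proj o ⊢var) (⊢pair (⊢renTm (typedRen-underΛ Γ) (⊢cpsVal V)) ⊢var))))
  ⊢cpsComp (handle M H N) =
    ⊢app (⊢app (⊢App-cpsC (⊢cpsComp M)) (⊢lam (⊢cpsComp N))) (⊢cpsHand H)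

  ⊢cpsHand : ∀ {n Γ S C} (H : Handler Γ S C) → cpsCtx {n} Γ ⊢ cpsHand H ∶ cpsH S (cpsC C)
  ⊢cpsHand []      = ⊢unit
  ⊢cpsHand (H ∷ M) = ⊢pair (⊢cpsHand H) (⊢lam (⊢subTm typedSub-σpat (⊢cpsComp M)))

  ⊢let-continuation : ∀ {n Γ A B S} (N : Comp (Γ ▸ A) (B ! S)) →
    (handlerTy S ∷ contTy B ∷ map (renTy suc) (cpsCtx {n} Γ))
      ⊢ lam (cpsV A) (run (renTm (extρ suc₂) (cpsComp N)) (tv zero) (var (suc (suc zero))) (var (suc zero)))
      ∶ contTy A
  ⊢let-continuation {Γ = Γ} N =
    ⊢lam (⊢app (⊢app (⊢App-cpsC (⊢renTm (typedRen-extρ _ (typedRen-underΛ Γ)) (⊢cpsComp N))) ⊢var) ⊢var)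

-- Administrative reductions

σ₂ : ∀ {n m} → Tm n m → Tm n m → Fin (suc (suc m)) → Tm n m
σ₂ a b zero          = b
σ₂ a b (suc zero)    = a
σ₂ a b (suc (suc i)) = var i

β-fun₂ : ∀ {n m} {Γ : Vec (Ty n) m} {A B T c a b} →
  (B ∷ A ∷ Γ) ⊢ c ∶ T → Γ ⊢ a ∶ A → Γ ⊢ b ∶ B →
  Γ ⊢ app (app (lam A (lam B c)) a) b ≐ subTm (σ₂ a b) c ∶ T
β-fun₂ {A = A} {B} {c = c} {a} {b} dc da db =
  ≐trans (app-cong (β-fun (⊢lam dc) da) (≐refl db))
         (≐-castʳ (β-fun (⊢subTm s dc) db) (subTm-subTm e c))
  where
  s : TypedSub (B ∷ A ∷ _) (B ∷ _) (extσ (σ₀ a))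
  s = typedSub λ { zero → ⊢var ; (suc zero) → ⊢renTm (typedRen-suc B) da ; (suc (suc i)) → ⊢var }
  e : ∀ i → subTm (σ₀ b) (extσ (σ₀ a) i) ≡ σ₂ a b i
  e zero          = refl
  e (suc zero)    = trans (subTm-renTm (λ _ → refl) a) (subTm-id (λ _ → refl) a)
  e (suc (suc i)) = refl

subTm-σ₂-wk₂ : ∀ {n m m'} (ρ : Fin m → Fin m') (k h : Tm n m') (t : Tm n m) →
  subTm (σ₂ k h) (renTm (extρ (extρ ρ)) (wk₂ t)) ≡ renTm ρ t
subTm-σ₂-wk₂ ρ k h t =
  trans (subTm-renTm (λ _ → refl) (wk₂ t)) (trans (subTm-renTm (λ _ → refl) t) (subTm-var (λ _ → refl) t))

subTm-extσ-σ₂-wk₂ : ∀ {n m m'} (ρ : Fin m → Fin m') (k h : Tm n m') (t : Tm n (suc m)) →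
  subTm (extσ (σ₂ k h)) (renTm (extρ (extρ (extρ ρ))) (renTm (extρ suc₂) t)) ≡ renTm (extρ ρ) t
subTm-extσ-σ₂-wk₂ ρ k h t =
  trans (subTm-renTm (λ _ → refl) (renTm (extρ suc₂) t))
        (trans (subTm-renTm e t) (subTm-var (λ _ → refl) t))
  where
  e : ∀ i → extσ (σ₂ k h) (extρ (extρ (extρ ρ)) (extρ suc₂ i)) ≡ var (extρ ρ i)
  e zero    = refl
  e (suc i) = refl

map-subTy-σT₀-suc : ∀ {n m} (B : Ty n) (Γ : Vec (Ty n) m) → map (subTy (σT₀ B)) (map (renTy suc) Γ) ≡ Γ
map-subTy-σT₀-suc B Γ =
  trans (sym (map-∘ _ _ Γ)) (trans (map-cong (subTy-σT₀-suc B) Γ) (map-id Γ))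

run-β : ∀ {n m} {G : Vec (Ty n) m} {A S b B k h} →
  G ⊢ Lam (lam (contTy A) (lam (handlerTy S) b)) ∶ cpsC (A ! S) →
  G ⊢ k ∶ cpsV A ⟶ B → G ⊢ h ∶ cpsH S B →
  G ⊢ run (Lam (lam (contTy A) (lam (handlerTy S) b))) B k h ≐ subTm (σ₂ k h) (tySubTm (σT₀ B) b) ∶ B
run-β {G = G} {A} {S} {b} {B} {k} {h} dΛ dk dh =
  ≐trans (app-cong (app-cong (≐-castʳ (≐-castTy (β-all (⊢Lam⁻¹ dΛ)) (cpsC-instance A S B)) body)
                             (≐refl dk))
                   (≐refl dh))
         (β-fun₂ db' dk dh)
  where
  body : tySubTm (σT₀ B) (lam (contTy A) (lam (handlerTy S) b))
       ≡ lam (cpsV A ⟶ B) (lam (cpsH S B) (tySubTm (σT₀ B) b))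
  body rewrite subTy-cpsV (σT₀ B) A | subTy-cpsH (σT₀ B) S (tv zero) = refl
  db' : (cpsH S B ∷ (cpsV A ⟶ B) ∷ G) ⊢ tySubTm (σT₀ B) b ∶ B
  db' = ⊢-castCtx (⊢tySubTm (σT₀ B) (⊢lam⁻¹ (⊢lam⁻¹ (⊢Lam⁻¹ dΛ))))
          (cong₂ _∷_ (subTy-cpsH (σT₀ B) S (tv zero))
                     (cong₂ _∷_ (cong (_⟶ B) (subTy-cpsV (σT₀ B) A)) (map-subTy-σT₀-suc B G)))

η-cpsC : ∀ {n m} {G : Vec (Ty n) m} {A S t} → G ⊢ t ∶ cpsC (A ! S) →
  G ⊢ t ≐ Lam (lam (contTy A) (lam (handlerTy S) (run (wk₂ (tyRenTm suc t)) (tv zero) (var (suc zero)) (var zero))))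
    ∶ cpsC (A ! S)
η-cpsC {G = G} {A} {S} {t} d =
  ≐trans (η-all d) (Lam-cong (≐trans (η-fun dβ) (lam-cong (≐-castʳ (η-fun dk) eq))))
  where
  X : Ty _
  X = contTy A ⟶ (handlerTy S ⟶ tv zero)
  dβ : map (renTy suc) G ⊢ App (tyRenTm suc t) (tv zero) ∶ X
  dβ = ⊢-castTy (⊢App (⊢tyRenTm suc d)) (trans (subTy-renTy (λ _ → refl) X) (subTy-id e X))
    where
    e : ∀ i → σT₀ (tv zero) (extρ suc i) ≡ tv i
    e zero    = refl
    e (suc i) = refl
  dk : (contTy A ∷ map (renTy suc) G) ⊢ app (renTm suc (App (tyRenTm suc t) (tv zero))) (var zero)
         ∶ handlerTy S ⟶ tv zero
  dk = ⊢app (⊢renTm (typedRen-suc _) dβ) ⊢var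
  eq : lam (handlerTy S) (app (renTm suc (app (renTm suc (App (tyRenTm suc t) (tv zero))) (var zero))) (var zero))
     ≡ lam (handlerTy S) (run (wk₂ (tyRenTm suc t)) (tv zero) (var (suc zero)) (var zero))
  eq = cong (λ z → lam (handlerTy S) (app (app (App z (tv zero)) (var (suc zero))) (var zero)))
            (renTm-renTm (λ _ → refl) (tyRenTm suc t))

η-cpsComp : ∀ {n Γ A S} (M : Comp Γ (A ! S)) →
  cpsCtx {n} Γ ⊢ cpsComp M
    ≐ Lam (lam (contTy A) (lam (handlerTy S) (run (wk₂ (cpsComp M)) (tv zero) (var (suc zero)) (var zero))))
    ∶ cpsC (A ! S)
η-cpsComp M =
  ≐-castʳ (η-cpsC (⊢cpsComp M))
          (cong (λ z → Lam (lam _ (lam _ (run (wk₂ z) (tv zero) (var (suc zero)) (var zero)))))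
                (tyRenTm-cpsComp suc M))

instantiate-wk₂ : ∀ {n m m'} (ρ : Fin m → Fin m') (k h : Tm n m') B (u : Tm (suc n) m) →
  subTm (σ₂ k h) (tySubTm (σT₀ B) (renTm (extρ (extρ ρ)) (wk₂ u))) ≡ renTm ρ (tySubTm (σT₀ B) u)
instantiate-wk₂ ρ k h B u =
  trans (cong (subTm (σ₂ k h)) (trans (sym (renTm-tySubTm-comm _ _ (wk₂ u)))
                                      (cong (renTm _) (sym (renTm-tySubTm-comm _ _ u)))))
        (subTm-σ₂-wk₂ ρ k h (tySubTm (σT₀ B) u))

instantiate-extρ-suc₂ : ∀ {n m m'} (ρ : Fin m → Fin m') (k h : Tm n m') B (u : Tm (suc n) (suc m)) →
  subTm (extσ (σ₂ k h)) (tySubTm (σT₀ B) (renTm (extρ (extρ (extρ ρ))) (renTm (extρ suc₂) u)))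
    ≡ renTm (extρ ρ) (tySubTm (σT₀ B) u)
instantiate-extρ-suc₂ ρ k h B u =
  trans (cong (subTm (extσ (σ₂ k h))) (trans (sym (renTm-tySubTm-comm _ _ (renTm (extρ suc₂) u)))
                                             (cong (renTm _) (sym (renTm-tySubTm-comm _ _ u)))))
        (subTm-extσ-σ₂-wk₂ ρ k h (tySubTm (σT₀ B) u))

-- The lemmas are stated for a renamed translation so that they also apply under the Λβ.λk.λh of a let.
run-ret : ∀ {n m Γ A S} {G' : Vec (Ty n) m} {ρ B k h} → TypedRen (cpsCtx Γ) G' ρ → (V : Val Γ A) →
  G' ⊢ k ∶ cpsV A ⟶ B → G' ⊢ h ∶ cpsH S B →
  G' ⊢ run (renTm ρ (cpsComp (ret {S = S} V))) B k h ≐ app k (renTm ρ (cpsVal V)) ∶ B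
run-ret {ρ = ρ} {B} {k} {h} r V dk dh =
  ≐-castʳ (run-β (⊢renTm r (⊢cpsComp (ret V))) dk dh)
          (cong (app k) (trans (instantiate-wk₂ ρ k h B (cpsVal V)) (cong (renTm ρ) (tySubTm-cpsVal _ V))))

run-let : ∀ {n m Γ A B S} {G' : Vec (Ty n) m} {ρ T k h} → TypedRen (cpsCtx Γ) G' ρ →
  (M : Comp Γ (A ! S)) (N : Comp (Γ ▸ A) (B ! S)) →
  G' ⊢ k ∶ cpsV B ⟶ T → G' ⊢ h ∶ cpsH S T →
  G' ⊢ run (renTm ρ (cpsComp (`let M N))) T k h
     ≐ run (renTm ρ (cpsComp M)) T
           (lam (cpsV A) (run (renTm (extρ ρ) (cpsComp N)) T (renTm suc k) (renTm suc h))) h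
     ∶ T
run-let {A = A} {ρ = ρ} {T} {k} {h} r M N dk dh =
  ≐-castʳ (run-β (⊢renTm r (⊢cpsComp (`let M N))) dk dh) eq
  where
  f : Tm _ _ → Tm _ _ → Ty _ → Tm _ _
  f z w a = app (app (App z T) (lam a (app (app (App w T) (renTm suc k)) (renTm suc h)))) h
  eq : f (subTm (σ₂ k h) (tySubTm (σT₀ T) (renTm (extρ (extρ ρ)) (wk₂ (cpsComp M)))))
         (subTm (extσ (σ₂ k h))
                (tySubTm (σT₀ T) (renTm (extρ (extρ (extρ ρ))) (renTm (extρ suc₂) (cpsComp N)))))
         (subTy (σT₀ T) (cpsV A))
     ≡ f (renTm ρ (cpsComp M)) (renTm (extρ ρ) (cpsComp N)) (cpsV A)
  eq = trans (cong₂ (λ z w → f z w (subTy (σT₀ T) (cpsV A)))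
                    (trans (instantiate-wk₂ ρ k h T (cpsComp M)) (cong (renTm ρ) (tySubTm-cpsComp _ M)))
                    (trans (instantiate-extρ-suc₂ ρ k h T (cpsComp N)) (cong (renTm (extρ ρ)) (tySubTm-cpsComp _ N))))
             (cong (f _ _) (subTy-cpsV (σT₀ T) A))

run-perform : ∀ {n m Γ A B S} {G' : Vec (Ty n) m} {ρ T k h} → TypedRen (cpsCtx Γ) G' ρ →
  (o : Op S A B) (V : Val Γ A) →
  G' ⊢ k ∶ cpsV B ⟶ T → G' ⊢ h ∶ cpsH S T →
  G' ⊢ run (renTm ρ (cpsComp (perform o V))) T k h ≐ app (proj o h) (pair (renTm ρ (cpsVal V)) k) ∶ T
run-perform {ρ = ρ} {T} {k} {h} r o V dk dh =
  ≐-castʳ (run-β (⊢renTm r (⊢cpsComp (perform o V))) dk dh)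
          (cong₂ app proj-h (cong (λ z → pair z k) (trans (instantiate-wk₂ ρ k h T (cpsVal V))
                                                           (cong (renTm ρ) (tySubTm-cpsVal _ V)))))
  where
  proj-h : subTm (σ₂ k h) (tySubTm (σT₀ T) (renTm (extρ (extρ ρ)) (proj o (var zero)))) ≡ proj o h
  proj-h = trans (cong (λ z → subTm (σ₂ k h) (tySubTm (σT₀ T) z)) (renTm-proj _ o (var zero)))
                 (trans (cong (subTm (σ₂ k h)) (tySubTm-proj _ o (var zero))) (subTm-proj _ o (var zero)))

proj-cong : ∀ {n m S A B} {G : Vec (Ty n) m} {t t' β} (o : Op S A B) →
  G ⊢ t ≐ t' ∶ cpsH S β → G ⊢ proj o t ≐ proj o t' ∶ (cpsV A ⊠ (cpsV B ⟶ β)) ⟶ β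
proj-cong here      d = snd-cong d
proj-cong (there o) d = proj-cong o (fst-cong d)

proj-cpsHand : ∀ {n Γ S A B C} (H : Handler Γ S C) (o : Op S A B) →
  cpsCtx {n} Γ ⊢ proj o (cpsHand H) ≐ lam (cpsV A ⊠ (cpsV B ⟶ cpsC C)) (subTm σpat (cpsComp (clause H o)))
    ∶ (cpsV A ⊠ (cpsV B ⟶ cpsC C)) ⟶ cpsC C
proj-cpsHand (H ∷ M) here      = β-snd (⊢cpsHand H) (⊢lam (⊢subTm typedSub-σpat (⊢cpsComp M)))
proj-cpsHand (H ∷ M) (there o) =
  ≐trans (proj-cong o (β-fst (⊢cpsHand H) (⊢lam (⊢subTm typedSub-σpat (⊢cpsComp M))))) (proj-cpsHand H o)

app-proj-cpsHand : ∀ {n Γ S A B C} (H : Handler Γ S C) (o : Op S A B) (V : Val Γ A) {K} →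
  cpsCtx {n} Γ ⊢ K ∶ cpsV B ⟶ cpsC C →
  cpsCtx Γ ⊢ app (proj o (cpsHand H)) (pair (cpsVal V) K) ≐ subTm (σ₂ (cpsVal V) K) (cpsComp (clause H o))
    ∶ cpsC C
app-proj-cpsHand {n} {Γ} {A = A} {B} {C} H o V {K} dK =
  ≐trans (app-cong (proj-cpsHand H o) (≐refl dp))
  (≐trans (≐-castʳ (β-fun (⊢subTm typedSub-σpat dc) dp) (subTm-subTm e c))
  (≐trans (≐sym (β-fun₂ dc (⊢fst dp) (⊢snd dp)))
  (≐trans (app-cong (app-cong (≐refl (⊢lam (⊢lam dc))) (β-fst (⊢cpsVal V) dK)) (β-snd (⊢cpsVal V) dK))
          (β-fun₂ dc (⊢cpsVal V) dK))))
  where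
  c : Tm n (suc (suc (len Γ)))
  c = cpsComp (clause H o)
  dc : ((cpsV B ⟶ cpsC C) ∷ cpsV A ∷ cpsCtx Γ) ⊢ c ∶ cpsC C
  dc = ⊢cpsComp (clause H o)
  dp : cpsCtx Γ ⊢ pair (cpsVal V) K ∶ cpsV A ⊠ (cpsV B ⟶ cpsC C)
  dp = ⊢pair (⊢cpsVal V) dK
  e : ∀ i → subTm (σ₀ (pair (cpsVal V) K)) (σpat i) ≡ σ₂ (fst (pair (cpsVal V) K)) (snd (pair (cpsVal V) K)) i
  e zero          = refl
  e (suc zero)    = refl
  e (suc (suc i)) = refl

-- Substituting σpat is a renaming followed by two β-steps, and βη-equality is stable under renaming.
subTm-σpat-cong : ∀ {n m} {G : Vec (Ty n) m} {A B T t t'} →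
  (B ∷ A ∷ G) ⊢ t ∶ T → (B ∷ A ∷ G) ⊢ t' ∶ T → (B ∷ A ∷ G) ⊢ t ≐ t' ∶ T →
  ((A ⊠ B) ∷ G) ⊢ subTm σpat t ≐ subTm σpat t' ∶ T
subTm-σpat-cong {A = A} {B} {t = t} {t'} dt dt' d =
  ≐trans (≐-castˡ (≐sym (β-fun₂ (⊢renTm r dt) (⊢fst ⊢var) (⊢snd ⊢var))) (eq t))
  (≐trans (app-cong (app-cong (lam-cong (lam-cong (≐-renTm r d))) (≐refl (⊢fst ⊢var))) (≐refl (⊢snd ⊢var)))
          (≐-castʳ (β-fun₂ (⊢renTm r dt') (⊢fst ⊢var) (⊢snd ⊢var)) (eq t')))
  where
  r : TypedRen (B ∷ A ∷ _) (B ∷ A ∷ (A ⊠ B) ∷ _) (extρ (extρ suc))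
  r = typedRen-extρ _ (typedRen-extρ _ (typedRen-suc _))
  e : ∀ {m} (i : Fin (suc (suc m))) → σ₂ (fst (var zero)) (snd (var zero)) (extρ (extρ suc) i) ≡ σpat i
  e zero          = refl
  e (suc zero)    = refl
  e (suc (suc i)) = refl
  eq : ∀ u → subTm (σ₂ (fst (var zero)) (snd (var zero))) (renTm (extρ (extρ suc)) u) ≡ subTm σpat u
  eq u = subTm-renTm e u

-- Soundness for the equational theory

typedRen-id : ∀ {n m} {G : Vec (Ty n) m} → TypedRen G G id
typedRen-id = typedRen λ _ → refl

cpsSub-sub₀ : ∀ {n Γ A} (V : Val Γ A) → CpsSub {n} (sub₀ V) (σ₀ (cpsVal V))
cpsSub-sub₀ V = cpsSub λ { vz → refl ; (vs x) → refl }

cpsSub-sub₂ : ∀ {n Γ A B} (V : Val Γ A) (W : Val Γ B) → CpsSub {n} (sub₂ V W) (σ₂ (cpsVal V) (cpsVal W))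
cpsSub-sub₂ V W = cpsSub λ { vz → refl ; (vs vz) → refl ; (vs (vs x)) → refl }

subTm-σ₀-wk₂ : ∀ {n m} (v : Tm n m) (t : Tm n (suc m)) →
  subTm (σ₀ (wk₂ v)) (renTm (extρ suc₂) t) ≡ wk₂ (subTm (σ₀ v) t)
subTm-σ₀-wk₂ v t = trans (subTm-renTm e₁ t) (sym (renTm-subTm e₂ t))
  where
  τ : Fin _ → Tm _ _
  τ zero    = wk₂ v
  τ (suc i) = var (suc (suc i))
  e₁ : ∀ i → σ₀ (wk₂ v) (extρ suc₂ i) ≡ τ i
  e₁ zero    = refl
  e₁ (suc i) = refl
  e₂ : ∀ i → renTm suc₂ (σ₀ v i) ≡ τ i
  e₂ zero    = refl
  e₂ (suc i) = refl

cpsComp-renC-extR-vs : ∀ {n m Γ A B C} (ρ : Fin (len Γ) → Fin m) (N : Comp (Γ ▸ A) C) →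
  renTm (extρ (extρ ρ)) (cpsComp {n = n} (renC (extR (vs {B = B})) N))
    ≡ renTm (extρ suc) (renTm (extρ ρ) (cpsComp N))
cpsComp-renC-extR-vs ρ N =
  trans (cong (renTm _) (cpsComp-renC (cpsRen-ext cpsRen-vs) N))
        (trans (renTm-renTm e₁ (cpsComp N)) (sym (renTm-renTm e₂ (cpsComp N))))
  where
  τ : Fin _ → Fin _
  τ zero    = zero
  τ (suc i) = suc (suc (ρ i))
  e₁ : ∀ i → extρ (extρ ρ) (extρ suc i) ≡ τ i
  e₁ zero    = refl
  e₁ (suc i) = refl
  e₂ : ∀ i → extρ suc (extρ ρ i) ≡ τ i
  e₂ zero    = refl
  e₂ (suc i) = refl

cpsComp-handle : ∀ {n Γ A S C} (M : Comp Γ (A ! S)) (H : Handler Γ S C) (N : Comp (Γ ▸ A) C) →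
  run (renTm id (cpsComp {n = n} M)) (cpsC C) (lam (cpsV A) (cpsComp N)) (cpsHand H) ≡ cpsComp (handle M H N)
cpsComp-handle M H N = cong (λ z → run z _ _ _) (renTm-id (λ _ → refl) (cpsComp M))

cps-ret-cong : ∀ {n Γ A S} {V V' : Val Γ A} →
  cpsCtx {suc n} Γ ⊢ cpsVal V ≐ cpsVal V' ∶ cpsV A →
  cpsCtx {n} Γ ⊢ cpsComp (ret {S = S} V) ≐ cpsComp (ret V') ∶ cpsC (A ! S)
cps-ret-cong {Γ = Γ} d =
  Lam-cong (lam-cong (lam-cong (app-cong (≐refl ⊢var) (≐-renTm (typedRen-underΛ Γ) d))))

cps-let-cong : ∀ {n Γ A B S} {M M' : Comp Γ (A ! S)} {N N' : Comp (Γ ▸ A) (B ! S)} →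
  cpsCtx {suc n} Γ ⊢ cpsComp M ≐ cpsComp M' ∶ cpsC (A ! S) →
  cpsCtx {suc n} (Γ ▸ A) ⊢ cpsComp N ≐ cpsComp N' ∶ cpsC (B ! S) →
  cpsCtx {n} Γ ⊢ cpsComp (`let M N) ≐ cpsComp (`let M' N') ∶ cpsC (B ! S)
cps-let-cong {Γ = Γ} dM dN =
  Lam-cong (lam-cong (lam-cong
    (app-cong (app-cong (App-cpsC-cong (≐-renTm (typedRen-underΛ Γ) dM))
                        (lam-cong (app-cong (app-cong (App-cpsC-cong (≐-renTm (typedRen-extρ _ (typedRen-underΛ Γ)) dN))
                                                      (≐refl ⊢var))
                                            (≐refl ⊢var))))
              (≐refl ⊢var))))

cps-perform-cong : ∀ {n Γ A B S} (o : Op S A B) {V V' : Val Γ A} →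
  cpsCtx {suc n} Γ ⊢ cpsVal V ≐ cpsVal V' ∶ cpsV A →
  cpsCtx {n} Γ ⊢ cpsComp (perform o V) ≐ cpsComp (perform o V') ∶ cpsC (B ! S)
cps-perform-cong {Γ = Γ} o d =
  Lam-cong (lam-cong (lam-cong (app-cong (≐refl (⊢proj o ⊢var))
                                         (pair-cong (≐-renTm (typedRen-underΛ Γ) d) (≐refl ⊢var)))))

cps-handle-cong : ∀ {n Γ A S C} {M M' : Comp Γ (A ! S)} {H H' : Handler Γ S C} {N N' : Comp (Γ ▸ A) C} →
  cpsCtx {n} Γ ⊢ cpsComp M ≐ cpsComp M' ∶ cpsC (A ! S) →
  cpsCtx {n} Γ ⊢ cpsHand H ≐ cpsHand H' ∶ cpsH S (cpsC C) →
  cpsCtx {n} (Γ ▸ A) ⊢ cpsComp N ≐ cpsComp N' ∶ cpsC C →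
  cpsCtx {n} Γ ⊢ cpsComp (handle M H N) ≐ cpsComp (handle M' H' N') ∶ cpsC C
cps-handle-cong dM dH dN = app-cong (app-cong (App-cpsC-cong dM) (lam-cong dN)) dH

cps-β-fun : ∀ {n Γ A C} (M : Comp (Γ ▸ A) C) (V : Val Γ A) →
  cpsCtx {n} Γ ⊢ app (lam (cpsV A) (cpsComp M)) (cpsVal V) ≐ cpsComp (M [ V ]₀) ∶ cpsC C
cps-β-fun M V = ≐-castʳ (β-fun (⊢cpsComp M) (⊢cpsVal V)) (sym (cpsComp-subC (cpsSub-sub₀ V) M))

cps-let-β : ∀ {n Γ A B S} (V : Val Γ A) (M : Comp (Γ ▸ A) (B ! S)) →
  cpsCtx {n} Γ ⊢ cpsComp (`let (ret V) M) ≐ cpsComp (M [ V ]₀) ∶ cpsC (B ! S)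
cps-let-β {Γ = Γ} V M =
  ≐trans (Lam-cong (lam-cong (lam-cong
           (≐trans (run-ret (typedRen-underΛ Γ) V (⊢let-continuation M) ⊢var)
                   (≐-castʳ (β-fun (⊢lam⁻¹ (⊢let-continuation M)) (⊢renTm (typedRen-underΛ Γ) (⊢cpsVal V)))
                            (cong (λ z → run z (tv zero) (var (suc zero)) (var zero)) M[V]))))))
         (≐sym (η-cpsComp (M [ V ]₀)))
  where
  M[V] : subTm (σ₀ (wk₂ (cpsVal V))) (renTm (extρ suc₂) (cpsComp M)) ≡ wk₂ (cpsComp (M [ V ]₀))
  M[V] = trans (subTm-σ₀-wk₂ (cpsVal V) (cpsComp M)) (cong wk₂ (sym (cpsComp-subC (cpsSub-sub₀ V) M)))

cps-let-η : ∀ {n Γ A S} (M : Comp Γ (A ! S)) →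
  cpsCtx {n} Γ ⊢ cpsComp (`let M (ret (var vz))) ≐ cpsComp M ∶ cpsC (A ! S)
cps-let-η {Γ = Γ} {A} {S} M =
  ≐trans (Lam-cong (lam-cong (lam-cong
           (app-cong (app-cong (≐refl (⊢App-cpsC (⊢renTm (typedRen-underΛ Γ) (⊢cpsComp M)))) k-η)
                     (≐refl ⊢var)))))
         (≐sym (η-cpsComp M))
  where
  k-η : (handlerTy S ∷ contTy A ∷ map (renTy suc) (cpsCtx Γ))
          ⊢ lam (cpsV A) (run (renTm (extρ suc₂) (cpsComp (ret {S = S} (var vz)))) (tv zero)
                              (var (suc (suc zero))) (var (suc zero)))
          ≐ var (suc zero) ∶ contTy A
  k-η = ≐trans (lam-cong (run-ret (typedRen-extρ _ (typedRen-underΛ Γ)) (var vz) ⊢var ⊢var))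
               (≐sym (η-fun ⊢var))

cps-let-assoc : ∀ {n Γ A B A' S}
  (L : Comp Γ (A ! S)) (M : Comp (Γ ▸ A) (B ! S)) (N : Comp (Γ ▸ B) (A' ! S)) →
  cpsCtx {n} Γ ⊢ cpsComp (`let (`let L M) N) ≐ cpsComp (`let L (`let M (renC (extR vs) N))) ∶ cpsC (A' ! S)
cps-let-assoc {Γ = Γ} {A} {B} L M N =
  Lam-cong (lam-cong (lam-cong
    (≐trans (run-let (typedRen-underΛ Γ) L M (⊢let-continuation N) ⊢var)
            (app-cong (app-cong (≐refl (⊢App-cpsC (⊢renTm (typedRen-underΛ Γ) (⊢cpsComp L))))
                                (lam-cong (≐sym (≐-castʳ
                                  (run-let (typedRen-extρ _ (typedRen-underΛ Γ)) M (renC (extR (vs {B = A})) N)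
                                           ⊢var ⊢var)
                                  (cong (λ z → run _ _ (lam (cpsV B) (run z _ _ _)) _)
                                        (cpsComp-renC-extR-vs suc₂ N))))))
                      (≐refl ⊢var)))))

cps-handle-ret : ∀ {n Γ A S C} (V : Val Γ A) (H : Handler Γ S C) (M : Comp (Γ ▸ A) C) →
  cpsCtx {n} Γ ⊢ cpsComp (handle (ret V) H M) ≐ cpsComp (M [ V ]₀) ∶ cpsC C
cps-handle-ret V H M =
  ≐trans (≐-castʳ (≐-castˡ (run-ret typedRen-id V (⊢lam (⊢cpsComp M)) (⊢cpsHand H))
                           (cpsComp-handle (ret V) H M))
                  (cong (app _) (renTm-id (λ _ → refl) _)))
         (cps-β-fun M V)

cps-handle-let : ∀ {n Γ A B S C}
  (L : Comp Γ (A ! S)) (M : Comp (Γ ▸ A) (B ! S)) (H : Handler Γ S C) (N : Comp (Γ ▸ B) C) →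
  cpsCtx {n} Γ ⊢ cpsComp (handle (`let L M) H N)
    ≐ cpsComp (handle L H (handle M (renH vs H) (renC (extR vs) N))) ∶ cpsC C
cps-handle-let {A = A} {B} {C = C} L M H N =
  ≐-castʳ (≐-castˡ (run-let typedRen-id L M (⊢lam (⊢cpsComp N)) (⊢cpsHand H)) (cpsComp-handle (`let L M) H N))
          (trans (cong₂ (λ l m → g l m (renTm suc (lam (cpsV B) (cpsComp N))) (renTm suc (cpsHand H)))
                        (renTm-id (λ _ → refl) _) (renTm-id (λ { zero → refl ; (suc i) → refl }) _))
                 (cong₂ (g (cpsComp L) (cpsComp M))
                        (cong (lam (cpsV B)) (sym (cpsComp-renC (cpsRen-ext cpsRen-vs) N)))
                        (sym (cpsHand-renH cpsRen-vs H))))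
  where
  g : Tm _ _ → Tm _ _ → Tm _ _ → Tm _ _ → Tm _ _
  g l m k h = run l (cpsC C) (lam (cpsV A) (run m (cpsC C) k h)) (cpsHand H)

cps-handle-op : ∀ {n Γ S A B C} (o : Op S A B) (V : Val Γ A) (H : Handler Γ S C) (M : Comp (Γ ▸ B) C) →
  cpsCtx {n} Γ ⊢ cpsComp (handle (perform o V) H M) ≐ cpsComp (subC (sub₂ V (lam M)) (clause H o)) ∶ cpsC C
cps-handle-op o V H M =
  ≐trans (≐-castʳ (≐-castˡ (run-perform typedRen-id o V (⊢lam (⊢cpsComp M)) (⊢cpsHand H))
                           (cpsComp-handle (perform o V) H M))
                  (cong (λ z → app _ (pair z _)) (renTm-id (λ _ → refl) _)))
         (≐-castʳ (app-proj-cpsHand H o V (⊢lam (⊢cpsComp M)))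
                  (sym (cpsComp-subC (cpsSub-sub₂ V (lam M)) (clause H o))))

mutual
  cps-≈v : ∀ {n Γ A} {V W : Val Γ A} → V ≈v W → cpsCtx {n} Γ ⊢ cpsVal V ≐ cpsVal W ∶ cpsV A
  cps-≈v (≈refl {V = V})         = ≐refl (⊢cpsVal V)
  cps-≈v (≈sym d)                = ≐sym (cps-≈v d)
  cps-≈v (≈trans d e)            = ≐trans (cps-≈v d) (cps-≈v e)
  cps-≈v (pair-cong d e)         = pair-cong (cps-≈v d) (cps-≈v e)
  cps-≈v (fst-cong d)            = fst-cong (cps-≈v d)
  cps-≈v (snd-cong d)            = snd-cong (cps-≈v d)
  cps-≈v (lam-cong d)            = lam-cong (cps-≈c d)
  cps-≈v (β-fst {V = V} {W = W}) = β-fst (⊢cpsVal V) (⊢cpsVal W)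
  cps-≈v (β-snd {V = V} {W = W}) = β-snd (⊢cpsVal V) (⊢cpsVal W)
  cps-≈v (η-pair {V = V})        = η-pair (⊢cpsVal V)
  cps-≈v (η-unit {V = V})        = η-unit (⊢cpsVal V)
  cps-≈v (η-fun {V = V})         =
    ≐-castʳ (η-fun (⊢cpsVal V)) (cong (λ z → lam _ (app z (var zero))) (sym (cpsVal-wkV V)))

  cps-≈c : ∀ {n Γ C} {M N : Comp Γ C} → M ≈c N → cpsCtx {n} Γ ⊢ cpsComp M ≐ cpsComp N ∶ cpsC C
  cps-≈c (≈refl {M = M})                               = ≐refl (⊢cpsComp M)
  cps-≈c (≈sym d)                                      = ≐sym (cps-≈c d)
  cps-≈c (≈trans d e)                                  = ≐trans (cps-≈c d) (cps-≈c e)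
  cps-≈c (app-cong d e)                                = app-cong (cps-≈v d) (cps-≈v e)
  cps-≈c (ret-cong d)                                  = cps-ret-cong (cps-≈v d)
  cps-≈c (let-cong d e)                                = cps-let-cong (cps-≈c d) (cps-≈c e)
  cps-≈c (perform-cong {o = o} d)                      = cps-perform-cong o (cps-≈v d)
  cps-≈c (handle-cong d e f)                           = cps-handle-cong (cps-≈c d) (cps-≈h e) (cps-≈c f)
  cps-≈c (β-fun {M = M} {V = V})                       = cps-β-fun M V
  cps-≈c (let-β {V = V} {M = M})                       = cps-let-β V M
  cps-≈c (let-η {M = M})                               = cps-let-η M
  cps-≈c (let-assoc {L = L} {M = M} {N = N})           = cps-let-assoc L M N
  cps-≈c (handle-ret {V = V} {H = H} {M = M})          = cps-handle-ret V H M
  cps-≈c (handle-let {L = L} {M = M} {H = H} {N = N})  = cps-handle-let L M H N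
  cps-≈c (handle-op {o = o} {V = V} {H = H} {M = M})   = cps-handle-op o V H M

  cps-≈h : ∀ {n Γ S C} {H H' : Handler Γ S C} → H ≈h H' →
    cpsCtx {n} Γ ⊢ cpsHand H ≐ cpsHand H' ∶ cpsH S (cpsC C)
  cps-≈h []                          = ≐refl ⊢unit
  cps-≈h (_∷_ {M = M} {M' = M'} d e) =
    pair-cong (cps-≈h d) (lam-cong (subTm-σpat-cong (⊢cpsComp M) (⊢cpsComp M') (cps-≈c e)))

-- Soundness for reduction

run-plug-perform : ∀ {n m Γ A A' B S} {G' : Vec (Ty n) m} {ρ T k h} → TypedRen (cpsCtx Γ) G' ρ →
  (E : ECtx Γ (B ! S) (A ! S)) (o : Op S A' B) (V : Val Γ A') →
  G' ⊢ k ∶ cpsV A ⟶ T → G' ⊢ h ∶ cpsH S T →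
  G' ⊢ run (renTm ρ (cpsComp (plug E (perform o V)))) T k h
     ≐ app (proj o h)
           (pair (renTm ρ (cpsVal V))
                 (lam (cpsV B) (run (renTm (extρ ρ) (cpsComp (plug (renE vs E) (ret (var vz)))))
                                    T (renTm suc k) (renTm suc h))))
     ∶ T
run-plug-perform r □ o V dk dh =
  ≐trans (run-perform r o V dk dh)
         (app-cong (≐refl (⊢proj o dh))
                   (pair-cong (≐refl (⊢renTm r (⊢cpsVal V)))
                              (≐trans (η-fun dk)
                                      (≐sym (lam-cong (run-ret (typedRen-extρ _ r) (var vz)
                                                               (⊢renTm (typedRen-suc _) dk)
                                                               (⊢renTm (typedRen-suc _) dh)))))))
run-plug-perform {Γ = Γ} {A = A} {B = B} {S = S} {G' = G'} {ρ} {T} {k} {h} r (`let {A = A₁} E N) o V dk dh =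
  ≐trans (run-let r (plug E (perform o V)) N dk dh)
  (≐trans (run-plug-perform r E o V dκ dh)
          (app-cong (≐refl (⊢proj o dh))
                    (pair-cong (≐refl (⊢renTm r (⊢cpsVal V)))
                               (lam-cong (≐sym (≐-castʳ
                                 (run-let (typedRen-extρ _ r) E[ret] (renC (extR vs) N) dk↑ dh↑)
                                 (cong (λ κ → run (renTm (extρ ρ) (cpsComp E[ret])) T κ (renTm suc h)) κ↑)))))))
  where
  E[ret] : Comp (Γ ▸ B) (A₁ ! S)
  E[ret] = plug (renE vs E) (ret (var vz))
  dk↑ : (cpsV B ∷ G') ⊢ renTm suc k ∶ cpsV A ⟶ T
  dk↑ = ⊢renTm (typedRen-suc _) dk
  dh↑ : (cpsV B ∷ G') ⊢ renTm suc h ∶ cpsH S T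
  dh↑ = ⊢renTm (typedRen-suc _) dh
  dκ : G' ⊢ lam (cpsV A₁) (run (renTm (extρ ρ) (cpsComp N)) T (renTm suc k) (renTm suc h)) ∶ cpsV A₁ ⟶ T
  dκ = ⊢lam (⊢app (⊢app (⊢App-cpsC (⊢renTm (typedRen-extρ _ r) (⊢cpsComp N))) (⊢renTm (typedRen-suc _) dk))
                  (⊢renTm (typedRen-suc _) dh))
  κ↑ : lam (cpsV A₁) (run (renTm (extρ (extρ ρ)) (cpsComp (renC (extR (vs {B = B})) N))) T
                          (renTm suc (renTm suc k)) (renTm suc (renTm suc h)))
     ≡ renTm suc (lam (cpsV A₁) (run (renTm (extρ ρ) (cpsComp N)) T (renTm suc k) (renTm suc h)))
  κ↑ = trans (cong₂ (λ n k' → lam (cpsV A₁) (run n T k' (renTm suc (renTm suc h))))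
                    (cpsComp-renC-extR-vs ρ N) (sym (renTm-extρ-suc suc k)))
             (cong (λ h' → lam (cpsV A₁) (run _ T _ h')) (sym (renTm-extρ-suc suc h)))

cps-β-op : ∀ {n Γ A A' B S C}
  (E : ECtx Γ (B ! S) (A ! S)) (o : Op S A' B) (V : Val Γ A') (H : Handler Γ S C) (M : Comp (Γ ▸ A) C) →
  cpsCtx {n} Γ ⊢ cpsComp (handle (plug E (perform o V)) H M)
    ≐ cpsComp (subC (sub₂ V (lam (handle (plug (renE vs E) (ret (var vz))) (renH vs H) (renC (extR vs) M))))
                    (clause H o))
    ∶ cpsC C
cps-β-op {Γ = Γ} {A} {B = B} {S} {C} E o V H M =
  ≐trans (≐-castʳ (≐-castˡ (run-plug-perform typedRen-id E o V (⊢lam (⊢cpsComp M)) (⊢cpsHand H))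
                           (cpsComp-handle (plug E (perform o V)) H M))
                  (cong₂ (λ a b → app (proj o (cpsHand H)) (pair a (lam (cpsV B) b)))
                         (renTm-id (λ _ → refl) _) resumption))
         (≐-castʳ (app-proj-cpsHand H o V (⊢cpsVal W)) (sym (cpsComp-subC (cpsSub-sub₂ V W) (clause H o))))
  where
  E[ret] : Comp (Γ ▸ B) (A ! S)
  E[ret] = plug (renE vs E) (ret (var vz))
  W : Val Γ (B ⇒ C)
  W = lam (handle E[ret] (renH vs H) (renC (extR vs) M))
  resumption : run (renTm (extρ id) (cpsComp E[ret])) (cpsC C)
                   (renTm suc (lam (cpsV A) (cpsComp M))) (renTm suc (cpsHand H))
             ≡ cpsComp (handle E[ret] (renH vs H) (renC (extR vs) M))
  resumption =
    trans (cong (λ z → run z (cpsC C) (renTm suc (lam (cpsV A) (cpsComp M))) (renTm suc (cpsHand H)))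
                (renTm-id (λ { zero → refl ; (suc i) → refl }) _))
          (cong₂ (run (cpsComp E[ret]) (cpsC C))
                 (cong (lam (cpsV A)) (sym (cpsComp-renC (cpsRen-ext cpsRen-vs) M)))
                 (sym (cpsHand-renH cpsRen-vs H)))

cps-⇝ : ∀ {n Γ C} {M N : Comp Γ C} → M ⇝ N → cpsCtx {n} Γ ⊢ cpsComp M ≐ cpsComp N ∶ cpsC C
cps-⇝ (β-let {V = V} {M = M})                      = cps-let-β V M
cps-⇝ (β-app {M = M} {V = V})                      = cps-β-fun M V
cps-⇝ (β-ret {V = V} {H = H} {M = M})              = cps-handle-ret V H M
cps-⇝ (β-op {E = E} {o = o} {V = V} {H = H} {M = M}) = cps-β-op E o V H M
cps-⇝ (ξ-let {N = N} d)                            = cps-let-cong (cps-⇝ d) (≐refl (⊢cpsComp N))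
cps-⇝ (ξ-handle {H = H} {N = N} d)                 =
  cps-handle-cong (cps-⇝ d) (≐refl (⊢cpsHand H)) (≐refl (⊢cpsComp N))

corollary5p10 :
  (∀ {Γ : Ctx} {A : VTy} {S : Sig} {M N : Comp Γ (A ! S)} →
     M ≈c N →
     cpsCtx {0} Γ ⊢ cpsComp M ≐ cpsComp N ∶ cpsC (A ! S))
  ×
  (∀ {A : VTy} {S : Sig} {M N : Comp ε (A ! S)} →
     M ⇝ N →
     [] ⊢ cpsComp {n = 0} M ≐ cpsComp N ∶ cpsC (A ! S))
corollary5p10 = cps-≈c , cps-⇝
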